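{- Let $p$ be the partially ordered pattern of length $4$ on the labels $\{1,2,3,4\}$ whose only relations are $1>4$ and $3>2$. Let $a(n)$ be the number of $n$-permutations avoiding $p$. Then $a(0)=a(1)=1$, $a(2)=2$, $a(3)=6$, $a(4)=18$, $a(5)=50$, and for $n\geq 6$, $$a(n)=4a(n-1)-5a(n-2)+4a(n-3).$$ Also, $$\sum_{n\geq 0}a(n)x^n=\frac{(1-x)^3}{1-4x+5x^2-4x^3}.$$
   Context: An $n$-permutation is a permutation $\pi=\pi_1\cdots\pi_n$ of $\{1,\dots,n\}$ written in one-line notation (for $n=0$ there is exactly one, the empty permutation). A partially ordered pattern (POP) $p$ of length $k$ is a partial order $<_P$ on the label set $\{1,\dots,k\}$. An occurrence of $p$ in $\pi$ is a subsequence $\pi_{i_1}\pi_{i_2}\cdots\pi_{i_k}$ with $1\leq i_1<\cdots<i_k\leq n$ such that $\pi_{i_j}<\pi_{i_m}$ whenever $j<_P m$ (no condition is imposed on pairs of incomparable labels). A permutation avoids $p$ if it contains no occurrence of $p$. -}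

module Defs where

open import Data.Nat as ℕ using (ℕ; zero; suc)
open import Data.Integer as ℤ using (ℤ; +_; -_)
open import Data.Fin as Fin using (Fin; zero; suc)
open import Data.Vec using (Vec; lookup)
open import Data.List using (List; length)
open import Data.List.Membership.Propositional using (_∈_)
open import Data.List.Relation.Unary.Unique.Propositional using (Unique)
open import Data.Product using (Σ; ∃; _×_)
open import Relation.Binary.PropositionalEquality using (_≡_)
open import Relation.Nullary using (¬_)
open import Function.Bundles using (_⇔_)

-- Words of length n over {1..n}, written 0-indexed as Vec (Fin n) n.
-- Position i (0-indexed) holds π_{i+1} - 1.

Word : ℕ → Set
Word n = Vec (Fin n) n

IsPerm : ∀ {n} → Word n → Set
IsPerm {n} π = ∀ (i j : Fin n) → lookup π i ≡ lookup π j → i ≡ j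

-- Partially ordered patterns of length k: a partial order on labels
-- (labels 1..k are represented by Fin k, label j ↦ j-1).
-- The strict relation  j <P m  means "label j < label m".

record POP (k : ℕ) : Set₁ where
  field
    _<P_     : Fin k → Fin k → Set
    irrefl   : ∀ j → ¬ (j <P j)
    trans    : ∀ {i j m} → i <P j → j <P m → i <P m

open POP public

Occurrence : ∀ {k n} → POP k → Word n → (Fin k → Fin n) → Set
Occurrence {k} p π ι =
  (∀ (j m : Fin k) → j Fin.< m → ι j Fin.< ι m) ×
  (∀ (j m : Fin k) → _<P_ p j m → lookup π (ι j) Fin.< lookup π (ι m))

Avoids : ∀ {k n} → POP k → Word n → Set
Avoids p π = ¬ (∃ λ ι → Occurrence p π ι)

NumAvoiders : ∀ {k} → POP k → ℕ → ℕ → Set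
NumAvoiders p n m =
  Σ (List (Word n)) λ L →
    Unique L × (∀ π → (π ∈ L) ⇔ (IsPerm π × Avoids p π)) × length L ≡ m

-- The specific pattern: relations 1 > 4 and 3 > 2 only,
-- i.e. label 4 <P label 1 and label 2 <P label 3 (0-indexed: 3<P0, 1<P2).

data Rel : Fin 4 → Fin 4 → Set where
  4<1 : Rel (suc (suc (suc zero))) zero
  2<3 : Rel (suc zero) (suc (suc zero))

Rel-irrefl : ∀ j → ¬ Rel j j
Rel-irrefl _ ()

Rel-trans : ∀ {i j m} → Rel i j → Rel j m → Rel i m
Rel-trans 4<1 ()
Rel-trans 2<3 ()

pat : POP 4
pat = record { _<P_ = Rel ; irrefl = Rel-irrefl ; trans = Rel-trans }

Series : Set
Series = ℕ → ℤ

sumUpTo : ℕ → (ℕ → ℤ) → ℤ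
sumUpTo zero    f = f 0
sumUpTo (suc n) f = sumUpTo n f ℤ.+ f (suc n)

_⋆_ : Series → Series → Series
(f ⋆ g) n = sumUpTo n (λ i → f i ℤ.* g (n ℕ.∸ i))

poly : List ℤ → Series
poly Data.List.[]       _       = + 0
poly (c Data.List.∷ cs) zero    = c
poly (c Data.List.∷ cs) (suc n) = poly cs n

toSeries : (ℕ → ℕ) → Series
toSeries a n = + (a n)

-- An occurrence of the pattern is i < j < k < l with π l < π i and π j < π k. Such an
-- occurrence cannot straddle a cut of a direct sum, so π avoids the pattern iff each of its
-- sum-indecomposable blocks does. An indecomposable avoider of size k ≥ 2 has a decreasing
-- interior (an interior ascent together with the descents crossing the nearby cuts would give an
-- occurrence), so it is determined by its two end values lo < hi and their order: there are
-- (k - 1)(k - 2) + 1 of them. Hence a(n + 1) = Σ_{r ≤ n} w(n - r) a(r) with w(j) = j² - j + 1,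
-- and since w has vanishing third difference, multiplying by (1 - x)³ yields the recurrence and
-- the generating function.

module Submission where

module Enumeration where

  open import Data.Nat
  open import Data.Nat.Properties
  open import Data.Nat.Induction using (<-rec)
  open import Data.Nat.ListAction using (sum)
  open import Data.Nat.Tactic.RingSolver using (solve-∀)
  open import Data.Product using (∃; ∃₂; _×_; _,_; proj₁; proj₂)
  open import Data.Sum using (_⊎_; inj₁; inj₂)
  open import Data.Empty using (⊥; ⊥-elim)
  open import Data.Unit using (⊤; tt)
  open import Data.Fin as Fin using (Fin; zero; suc; toℕ; fromℕ<)
  open import Data.Fin.Properties using (toℕ-fromℕ<; toℕ-injective; toℕ<n; injective⇒≤)
  open import Data.Vec using (Vec; []; _∷_; lookup; tabulate)
  open import Data.Vec.Properties using (lookup∘tabulate; tabulate∘lookup; tabulate-cong)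
  open import Data.List as List using (List; []; _∷_; _++_; map; length; applyUpTo; cartesianProductWith)
  open import Data.List.Properties using (length-++; length-map; length-applyUpTo; ∷-injective)
  open import Data.List.Membership.Propositional using (_∈_)
  open import Data.List.Membership.Propositional.Properties
    using (∈-++⁺ˡ; ∈-++⁺ʳ; ∈-++⁻; ∈-map⁺; ∈-map⁻; ∈-applyUpTo⁺; ∈-applyUpTo⁻;
           ∈-cartesianProductWith⁺; ∈-cartesianProductWith⁻; ∈-lookup)
  import Data.List.Membership.Setoid.Properties as SetoidMembership
  open import Data.List.Relation.Unary.Any using (here; there; index)
  open import Data.List.Relation.Unary.All as All using (All; []; _∷_)
  open import Data.List.Relation.Unary.AllPairs using ([]; _∷_)
  open import Data.List.Relation.Unary.Unique.Propositional using (Unique)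
  import Data.List.Relation.Unary.Unique.Propositional.Properties as Uniqueₚ
  open import Function using (_∘_; id)
  open import Function.Bundles using (Equivalence; mk⇔)
  open import Relation.Nullary using (¬_; Dec; yes; no; ¬?; _→-dec_)
  open import Relation.Nullary.Decidable using (decidable-stable)
  open import Relation.Binary using (Tri; tri<; tri≈; tri>)
  open import Relation.Binary.PropositionalEquality
  open import Defs using (POP; Word; IsPerm; Avoids; pat; NumAvoiders; Rel; 4<1; 2<3)

  punchIn : ℕ → ℕ → ℕ
  punchIn c y with y <? c
  ... | yes _ = y
  ... | no _ = suc y

  punchOut : ℕ → ℕ → ℕ
  punchOut c y with y <? c
  ... | yes _ = y
  ... | no _ = pred y

  punchIn-< : ∀ c y → y < c → punchIn c y ≡ y
  punchIn-< c y y<c with y <? c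
  ... | yes _ = refl
  ... | no y≮c = ⊥-elim (y≮c y<c)

  punchIn-≥ : ∀ c y → c ≤ y → punchIn c y ≡ suc y
  punchIn-≥ c y c≤y with y <? c
  ... | yes y<c = ⊥-elim (<⇒≱ y<c c≤y)
  ... | no _ = refl

  punchIn-≢ : ∀ c y → punchIn c y ≢ c
  punchIn-≢ c y with y <? c
  ... | yes y<c = λ y≡c → <-irrefl y≡c y<c
  ... | no y≮c = λ y+1≡c → y≮c (≤-reflexive y+1≡c)

  punchIn-≢-below : ∀ c y x → x < c → y ≢ x → punchIn c y ≢ x
  punchIn-≢-below c y x x<c y≢x with y <? c
  ... | yes _ = y≢x
  ... | no y≮c = λ y+1≡x → y≮c (<-trans (≤-reflexive y+1≡x) x<c)

  punchIn-≤ : ∀ c y → punchIn c y ≤ suc y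
  punchIn-≤ c y with y <? c
  ... | yes _ = n≤1+n y
  ... | no _ = ≤-refl

  punchIn-mono-< : ∀ c {y y′} → y < y′ → punchIn c y < punchIn c y′
  punchIn-mono-< c {y} {y′} y<y′ with y <? c | y′ <? c
  ... | yes _ | yes _ = y<y′
  ... | yes _ | no _ = m<n⇒m<1+n y<y′
  ... | no y≮c | yes y′<c = ⊥-elim (y≮c (<-trans y<y′ y′<c))
  ... | no _ | no _ = s<s y<y′

  punchIn-cancel-< : ∀ c {y y′} → punchIn c y < punchIn c y′ → y < y′
  punchIn-cancel-< c {y} {y′} lt with <-cmp y y′
  ... | tri< y<y′ _ _ = y<y′
  ... | tri≈ _ refl _ = ⊥-elim (<-irrefl refl lt)
  ... | tri> _ _ y>y′ = ⊥-elim (<-asym lt (punchIn-mono-< c y>y′))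

  punchIn-injective : ∀ c {y y′} → punchIn c y ≡ punchIn c y′ → y ≡ y′
  punchIn-injective c {y} {y′} eq with <-cmp y y′
  ... | tri< y<y′ _ _ = ⊥-elim (<-irrefl eq (punchIn-mono-< c y<y′))
  ... | tri≈ _ y≡y′ _ = y≡y′
  ... | tri> _ _ y>y′ = ⊥-elim (<-irrefl (sym eq) (punchIn-mono-< c y>y′))

  punchIn-punchOut : ∀ c y → y ≢ c → punchIn c (punchOut c y) ≡ y
  punchIn-punchOut c y y≢c with y <? c
  ... | yes y<c = punchIn-< c y y<c
  ... | no y≮c with y
  ...   | zero = ⊥-elim (y≢c (sym (n≤0⇒n≡0 (≮⇒≥ y≮c))))
  ...   | suc y₀ = punchIn-≥ c y₀ (s≤s⁻¹ (≤∧≢⇒< (≮⇒≥ y≮c) (y≢c ∘ sym)))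

  punchOut-< : ∀ c y M → y ≢ c → y < suc M → c < suc M → punchOut c y < M
  punchOut-< c y M y≢c y≤M c≤M with y <? c
  ... | yes y<c = <-≤-trans y<c (s≤s⁻¹ c≤M)
  ... | no y≮c with y
  ...   | zero = ⊥-elim (y≢c (sym (n≤0⇒n≡0 (≮⇒≥ y≮c))))
  ...   | suc _ = s≤s⁻¹ y≤M

  punchOut-injective : ∀ c {y y′} → y ≢ c → y′ ≢ c → punchOut c y ≡ punchOut c y′ → y ≡ y′
  punchOut-injective c {y} {y′} y≢c y′≢c eq = begin
    y                          ≡⟨ punchIn-punchOut c y y≢c ⟨
    punchIn c (punchOut c y)   ≡⟨ cong (punchIn c) eq ⟩
    punchIn c (punchOut c y′)  ≡⟨ punchIn-punchOut c y′ y′≢c ⟩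
    y′                         ∎
    where open ≡-Reasoning

  punchOut-mono-< : ∀ c {y y′} → y ≢ c → y′ ≢ c → y < y′ → punchOut c y < punchOut c y′
  punchOut-mono-< c {y} {y′} y≢c y′≢c y<y′ =
    punchIn-cancel-< c (subst₂ _<_ (sym (punchIn-punchOut c y y≢c)) (sym (punchIn-punchOut c y′ y′≢c)) y<y′)

  Bounded : ℕ → (ℕ → ℕ) → Set
  Bounded n f = ∀ i → i < n → f i < n

  InjectiveOn : ℕ → (ℕ → ℕ) → Set
  InjectiveOn n f = ∀ i j → i < n → j < n → f i ≡ f j → i ≡ j

  injectiveOn-≤ : ∀ {m n f} → m ≤ n → InjectiveOn n f → InjectiveOn m f
  injectiveOn-≤ m≤n inj i j i<m j<m = inj i j (<-≤-trans i<m m≤n) (<-≤-trans j<m m≤n)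

  injectiveOn-resp-≗ : ∀ {n f g} → (∀ i → i < n → f i ≡ g i) → InjectiveOn n f → InjectiveOn n g
  injectiveOn-resp-≗ f≗g inj i j i<n j<n gi≡gj =
    inj i j i<n j<n (trans (f≗g i i<n) (trans gi≡gj (sym (f≗g j j<n))))

  -- Pigeonhole: punching out the value of the last point leaves m injective values below M.
  injectiveOn⇒≤ : ∀ m M (g : ℕ → ℕ) → (∀ i → i < m → g i < M) → InjectiveOn m g → m ≤ M
  injectiveOn⇒≤ zero M g bnd inj = z≤n
  injectiveOn⇒≤ (suc m) zero g bnd inj = ⊥-elim (n≮0 (bnd m ≤-refl))
  injectiveOn⇒≤ (suc m) (suc M) g bnd inj = s≤s (injectiveOn⇒≤ m M g′ bnd′ inj′)
    where
    g≢gm : ∀ i → i < m → g i ≢ g m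
    g≢gm i i<m eq = <-irrefl (inj i m (m<n⇒m<1+n i<m) ≤-refl eq) i<m
    g′ : ℕ → ℕ
    g′ i = punchOut (g m) (g i)
    bnd′ : ∀ i → i < m → g′ i < M
    bnd′ i i<m = punchOut-< (g m) (g i) M (g≢gm i i<m) (bnd i (m<n⇒m<1+n i<m)) (bnd m ≤-refl)
    inj′ : InjectiveOn m g′
    inj′ i j i<m j<m eq =
      inj i j (m<n⇒m<1+n i<m) (m<n⇒m<1+n j<m) (punchOut-injective (g m) (g≢gm i i<m) (g≢gm j j<m) eq)

  ≮⇒>-injectiveOn : ∀ {n} f → InjectiveOn n f → ∀ i l → i < n → l < n → i ≢ l → ¬ f i < f l → f l < f i
  ≮⇒>-injectiveOn f inj i l i<n l<n i≢l fi≮fl with <-cmp (f i) (f l)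
  ... | tri< fi<fl _ _ = ⊥-elim (fi≮fl fi<fl)
  ... | tri≈ _ fi≡fl _ = ⊥-elim (i≢l (inj i l i<n l<n fi≡fl))
  ... | tri> _ _ fl<fi = fl<fi

  ∀<? : ∀ {P : ℕ → Set} → (∀ i → Dec (P i)) → ∀ m → Dec (∀ i → i < m → P i)
  ∀<? P? m with allUpTo? P? m
  ... | yes all = yes (λ i → all)
  ... | no ¬all = no (λ all → ¬all (all _))

  ¬∀<⇒∃¬ : ∀ {P : ℕ → Set} → (∀ i → Dec (P i)) → ∀ m →
           ¬ (∀ i → i < m → P i) → ∃ λ i → i < m × ¬ P i
  ¬∀<⇒∃¬ P? m ¬all with anyUpTo? (¬? ∘ P?) m
  ... | yes counterexample = counterexample
  ... | no none = ⊥-elim (¬all (λ i i<m → decidable-stable (P? i) (λ ¬Pi → none (i , i<m , ¬Pi))))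

  Least : (ℕ → Set) → ℕ → Set
  Least P c = P c × (∀ c′ → c′ < c → ¬ P c′)

  least-or-none : ∀ {P : ℕ → Set} → (∀ i → Dec (P i)) → ∀ N →
                  (∃ λ c → c ≤ N × Least P c) ⊎ (∀ c → c ≤ N → ¬ P c)
  least-or-none P? zero with P? 0
  ... | yes P0 = inj₁ (0 , z≤n , P0 , λ _ ())
  ... | no ¬P0 = inj₂ (λ { zero _ → ¬P0 })
  least-or-none P? (suc N) with least-or-none P? N
  ... | inj₁ (c , c≤N , least) = inj₁ (c , m≤n⇒m≤1+n c≤N , least)
  ... | inj₂ none with P? (suc N)
  ...   | yes PN = inj₁ (suc N , ≤-refl , PN , λ c′ c′<N → none c′ (s≤s⁻¹ c′<N))
  ...   | no ¬PN = inj₂ none′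
    where
    none′ : ∀ c → c ≤ suc N → ¬ _
    none′ c c≤N with m≤n⇒m<n∨m≡n c≤N
    ... | inj₁ c<N = none c (s≤s⁻¹ c<N)
    ... | inj₂ refl = ¬PN

  least : ∀ {P : ℕ → Set} → (∀ i → Dec (P i)) → ∀ N → P N → ∃ λ c → c ≤ N × Least P c
  least P? N PN with least-or-none P? N
  ... | inj₁ found = found
  ... | inj₂ none = ⊥-elim (none N ≤-refl PN)

  -- Avoidance, direct sums and cuts

  Avoiding : ℕ → (ℕ → ℕ) → Set
  Avoiding n f = ∀ i j k l → i < j → j < k → k < l → l < n → f l < f i → f j < f k → ⊥

  avoiding-≤ : ∀ {m n f} → m ≤ n → Avoiding n f → Avoiding m f
  avoiding-≤ m≤n av i j k l i<j j<k k<l l<m = av i j k l i<j j<k k<l (<-≤-trans l<m m≤n)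

  avoiding-resp-≗ : ∀ {n f g} → (∀ i → i < n → f i ≡ g i) → Avoiding n f → Avoiding n g
  avoiding-resp-≗ f≗g av i j k l i<j j<k k<l l<n gl<gi gj<gk =
    av i j k l i<j j<k k<l l<n
      (subst₂ _<_ (sym (f≗g l l<n)) (sym (f≗g i (<-trans i<j (<-trans j<k (<-trans k<l l<n))))) gl<gi)
      (subst₂ _<_ (sym (f≗g j (<-trans j<k (<-trans k<l l<n)))) (sym (f≗g k (<-trans k<l l<n))) gj<gk)

  _⊕[_]_ : (ℕ → ℕ) → ℕ → (ℕ → ℕ) → ℕ → ℕ
  (g ⊕[ c ] h) i with i <? c
  ... | yes _ = g i
  ... | no _ = c + h (i ∸ c)

  ⊕-< : ∀ g c h i → i < c → (g ⊕[ c ] h) i ≡ g i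
  ⊕-< g c h i i<c with i <? c
  ... | yes _ = refl
  ... | no i≮c = ⊥-elim (i≮c i<c)

  ⊕-+ : ∀ g c h i → (g ⊕[ c ] h) (c + i) ≡ c + h i
  ⊕-+ g c h i with c + i <? c
  ... | yes c+i<c = ⊥-elim (m+n≮m c i c+i<c)
  ... | no _ = cong (λ x → c + h x) (m+n∸m≡n c i)

  data SplitAt (c : ℕ) : ℕ → Set where
    left : ∀ {i} → i < c → SplitAt c i
    right : ∀ i → SplitAt c (c + i)

  splitAt : ∀ c i → SplitAt c i
  splitAt c i with i <? c
  ... | yes i<c = left i<c
  ... | no i≮c = subst (SplitAt c) (m+[n∸m]≡n (≮⇒≥ i≮c)) (right (i ∸ c))

  ⊕-bounded : ∀ {g c h m} → Bounded c g → Bounded m h → Bounded (c + m) (g ⊕[ c ] h)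
  ⊕-bounded {g} {c} {h} {m} bg bh i i<c+m with splitAt c i
  ... | left i<c rewrite ⊕-< g c h i i<c = <-≤-trans (bg i i<c) (m≤m+n c m)
  ... | right i rewrite ⊕-+ g c h i = +-monoʳ-< c (bh i (+-cancelˡ-< c i m i<c+m))

  ⊕-injectiveOn : ∀ {g c h m} → Bounded c g → InjectiveOn c g → InjectiveOn m h →
                  InjectiveOn (c + m) (g ⊕[ c ] h)
  ⊕-injectiveOn {g} {c} {h} {m} bg ig ih i j i< j< eq with splitAt c i | splitAt c j
  ... | left i<c | left j<c rewrite ⊕-< g c h i i<c | ⊕-< g c h j j<c = ig i j i<c j<c eq
  ... | left i<c | right j rewrite ⊕-< g c h i i<c | ⊕-+ g c h j =
    ⊥-elim (<-irrefl eq (<-≤-trans (bg i i<c) (m≤m+n c _)))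
  ... | right i | left j<c rewrite ⊕-< g c h j j<c | ⊕-+ g c h i =
    ⊥-elim (<-irrefl (sym eq) (<-≤-trans (bg j j<c) (m≤m+n c _)))
  ... | right i | right j rewrite ⊕-+ g c h i | ⊕-+ g c h j =
    cong (c +_) (ih i j (+-cancelˡ-< c i m i<) (+-cancelˡ-< c j m j<) (+-cancelˡ-≡ c _ _ eq))

  -- An occurrence has its last entry below its first, so it cannot straddle the sum.
  ⊕-avoiding : ∀ {g c h m} → Bounded c g → Avoiding c g → Avoiding m h → Avoiding (c + m) (g ⊕[ c ] h)
  ⊕-avoiding {g} {c} {h} {m} bg ag ah i j k l i<j j<k k<l l<c+m fl<fi fj<fk with splitAt c l
  ... | left l<c
    rewrite ⊕-< g c h l l<c | ⊕-< g c h i (<-trans i<j (<-trans j<k (<-trans k<l l<c)))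
          | ⊕-< g c h j (<-trans j<k (<-trans k<l l<c)) | ⊕-< g c h k (<-trans k<l l<c) =
    ag i j k l i<j j<k k<l l<c fl<fi fj<fk
  ... | right l with splitAt c i
  ...   | left i<c rewrite ⊕-+ g c h l | ⊕-< g c h i i<c =
    <-asym fl<fi (<-≤-trans (bg i i<c) (m≤m+n c _))
  ...   | right i with splitAt c j | splitAt c k
  ...     | left j<c | _ = <-asym j<c (≤-<-trans (m≤m+n c i) i<j)
  ...     | right _ | left k<c = <-asym k<c (≤-<-trans (m≤m+n c i) (<-trans i<j j<k))
  ...     | right j | right k rewrite ⊕-+ g c h l | ⊕-+ g c h i | ⊕-+ g c h j | ⊕-+ g c h k =
    ah i j k l (+-cancelˡ-< c i j i<j) (+-cancelˡ-< c j k j<k) (+-cancelˡ-< c k l k<l)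
       (+-cancelˡ-< c l m l<c+m) (+-cancelˡ-< c _ _ fl<fi) (+-cancelˡ-< c _ _ fj<fk)

  Indecomposable : ℕ → (ℕ → ℕ) → Set
  Indecomposable k f = ∀ c → 0 < c → c < k → ∃₂ λ i l → i < c × c ≤ l × l < k × f l < f i

  ⊕-indecomposable : ∀ {g c h} → Indecomposable c g → Indecomposable c (g ⊕[ c ] h)
  ⊕-indecomposable {g} {c} {h} indec d 0<d d<c with indec d 0<d d<c
  ... | i , l , i<d , d≤l , l<c , gl<gi =
    i , l , i<d , d≤l , l<c , subst₂ _<_ (sym (⊕-< g c h l l<c)) (sym (⊕-< g c h i (<-trans i<d d<c))) gl<gi

  Cut : ℕ → (ℕ → ℕ) → ℕ → Set
  Cut n f c = ∀ i → i < c → ∀ l → l < n → c ≤ l → f i < f l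

  cut? : ∀ n f c → Dec (Cut n f c)
  cut? n f c = ∀<? (λ i → ∀<? (λ l → (c ≤? l) →-dec (f i <? f l)) n) c

  cut-resp-≗ : ∀ {n f g c} → (∀ i → i < n → f i ≡ g i) → c ≤ n → Cut n f c → Cut n g c
  cut-resp-≗ f≗g c≤n cut i i<c l l<n c≤l =
    subst₂ _<_ (f≗g i (<-≤-trans i<c c≤n)) (f≗g l l<n) (cut i i<c l l<n c≤l)

  ⊕-cut : ∀ {g c h m} → Bounded c g → Cut (c + m) (g ⊕[ c ] h) c
  ⊕-cut {g} {c} {h} {m} bg i i<c l l<c+m c≤l with splitAt c l
  ... | left l<c = ⊥-elim (<⇒≱ l<c c≤l)
  ... | right l rewrite ⊕-< g c h i i<c | ⊕-+ g c h l = <-≤-trans (bg i i<c) (m≤m+n c _)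

  indecomposable⇒¬cut : ∀ {k n f c} → Indecomposable k f → 0 < c → c < k → k ≤ n → ¬ Cut n f c
  indecomposable⇒¬cut indec 0<c c<k k≤n cut with indec _ 0<c c<k
  ... | i , l , i<c , c≤l , l<k , fl<fi = <-asym fl<fi (cut i i<c l (<-≤-trans l<k k≤n) c≤l)

  -- Frames

  -- A frame of size k ≥ 2 starts and ends with the values lo < hi (in either
  -- order) and lists the remaining values of [0, k) in decreasing order between them.
  data Ends : Set where
    highLow lowHigh : Ends

  firstEntry lastEntry : Ends → ℕ → ℕ → ℕ
  firstEntry highLow lo hi = hi
  firstEntry lowHigh lo hi = lo
  lastEntry highLow lo hi = lo
  lastEntry lowHigh lo hi = hi

  -- lowHigh frames need a value below lo and one above hi, else they would decompose.
  FrameShape : ℕ → ℕ → ℕ → Ends → Set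
  FrameShape k lo hi highLow = lo < hi × hi < k
  FrameShape k lo hi lowHigh = lo < hi × hi < k × 0 < lo × suc hi < k

  shape-lo<hi : ∀ {k lo hi} e → FrameShape k lo hi e → lo < hi
  shape-lo<hi highLow = proj₁
  shape-lo<hi lowHigh = proj₁

  shape-hi<k : ∀ {k lo hi} e → FrameShape k lo hi e → hi < k
  shape-hi<k highLow = proj₂
  shape-hi<k lowHigh s = proj₁ (proj₂ s)

  shape-2≤k : ∀ {k lo hi} e → FrameShape k lo hi e → 2 ≤ k
  shape-2≤k {lo = lo} e s = <-≤-trans (s≤s (≤-<-trans (z≤n {lo}) (shape-lo<hi e s))) (shape-hi<k e s)

  firstEntry<k : ∀ {k lo hi} e → FrameShape k lo hi e → firstEntry e lo hi < k
  firstEntry<k highLow s = proj₂ s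
  firstEntry<k lowHigh s = <-trans (proj₁ s) (proj₁ (proj₂ s))

  lastEntry<k : ∀ {k lo hi} e → FrameShape k lo hi e → lastEntry e lo hi < k
  lastEntry<k highLow s = <-trans (proj₁ s) (proj₂ s)
  lastEntry<k lowHigh s = proj₁ (proj₂ s)

  firstEntry≢lastEntry : ∀ {lo hi} e → lo < hi → firstEntry e lo hi ≢ lastEntry e lo hi
  firstEntry≢lastEntry highLow lo<hi eq = <-irrefl (sym eq) lo<hi
  firstEntry≢lastEntry lowHigh lo<hi eq = <-irrefl eq lo<hi

  -- For lo < hi, skip lo hi e is the e-th (from 0) natural number other than lo and hi.
  skip : ℕ → ℕ → ℕ → ℕ
  skip lo hi e = punchIn hi (punchIn lo e)

  skip-≢-lo : ∀ {lo hi} e → lo < hi → skip lo hi e ≢ lo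
  skip-≢-lo {lo} {hi} e lo<hi = punchIn-≢-below hi (punchIn lo e) lo lo<hi (punchIn-≢ lo e)

  skip-≢-hi : ∀ {lo hi} e → skip lo hi e ≢ hi
  skip-≢-hi {lo} {hi} e = punchIn-≢ hi (punchIn lo e)

  skip-≢-firstEntry : ∀ {lo hi} ends e → lo < hi → skip lo hi e ≢ firstEntry ends lo hi
  skip-≢-firstEntry highLow e lo<hi = skip-≢-hi e
  skip-≢-firstEntry lowHigh e lo<hi = skip-≢-lo e lo<hi

  skip-≢-lastEntry : ∀ {lo hi} ends e → lo < hi → skip lo hi e ≢ lastEntry ends lo hi
  skip-≢-lastEntry highLow e lo<hi = skip-≢-lo e lo<hi
  skip-≢-lastEntry lowHigh e lo<hi = skip-≢-hi e

  skip-≤ : ∀ lo hi e → skip lo hi e ≤ 2 + e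
  skip-≤ lo hi e = ≤-trans (punchIn-≤ hi (punchIn lo e)) (s≤s (punchIn-≤ lo e))

  skip-mono-< : ∀ lo hi {e e′} → e < e′ → skip lo hi e < skip lo hi e′
  skip-mono-< lo hi e<e′ = punchIn-mono-< hi (punchIn-mono-< lo e<e′)

  skip-cancel-< : ∀ lo hi {e e′} → skip lo hi e < skip lo hi e′ → e < e′
  skip-cancel-< lo hi lt = punchIn-cancel-< lo (punchIn-cancel-< hi lt)

  skip-injective : ∀ lo hi {e e′} → skip lo hi e ≡ skip lo hi e′ → e ≡ e′
  skip-injective lo hi eq = punchIn-injective lo (punchIn-injective hi eq)

  frame : ℕ → ℕ → ℕ → Ends → ℕ → ℕ
  frame k lo hi e zero = firstEntry e lo hi
  frame k lo hi e (suc i) with 2 + i ≟ k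
  ... | yes _ = lastEntry e lo hi
  ... | no _ = skip lo hi (k ∸ (3 + i))

  frame-last : ∀ k lo hi e i → 2 + i ≡ k → frame k lo hi e (suc i) ≡ lastEntry e lo hi
  frame-last k lo hi e i 2+i≡k with 2 + i ≟ k
  ... | yes _ = refl
  ... | no 2+i≢k = ⊥-elim (2+i≢k 2+i≡k)

  frame-interior : ∀ k lo hi e i → 2 + i < k → frame k lo hi e (suc i) ≡ skip lo hi (k ∸ (3 + i))
  frame-interior k lo hi e i 2+i<k with 2 + i ≟ k
  ... | yes 2+i≡k = ⊥-elim (<-irrefl 2+i≡k 2+i<k)
  ... | no _ = refl

  data Position (k : ℕ) : ℕ → Set where
    first : Position k zero
    last : ∀ i → 2 + i ≡ k → Position k (suc i)
    interior : ∀ i → 2 + i < k → Position k (suc i)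

  position : ∀ k i → i < k → Position k i
  position k zero _ = first
  position k (suc i) 1+i<k with 2 + i ≟ k
  ... | yes 2+i≡k = last i 2+i≡k
  ... | no 2+i≢k = interior i (≤∧≢⇒< 1+i<k 2+i≢k)

  interior-bound : ∀ k i → 2 + i < k → 2 + (k ∸ (3 + i)) < k
  interior-bound k i 2+i<k = begin-strict
    2 + (k ∸ (3 + i))      ≡⟨ +-comm 2 (k ∸ (3 + i)) ⟩
    (k ∸ (3 + i)) + 2      <⟨ +-monoʳ-< (k ∸ (3 + i)) (m<m+n 2 (s≤s (z≤n {i}))) ⟩
    (k ∸ (3 + i)) + (3 + i) ≡⟨ m∸n+n≡m 2+i<k ⟩
    k                       ∎
    where open ≤-Reasoning

  frame-bounded : ∀ k lo hi e → FrameShape k lo hi e → Bounded k (frame k lo hi e)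
  frame-bounded k lo hi e s i i<k with position k i i<k
  ... | first = firstEntry<k e s
  ... | last j 2+j≡k rewrite frame-last k lo hi e j 2+j≡k = lastEntry<k e s
  ... | interior j 2+j<k rewrite frame-interior k lo hi e j 2+j<k =
    ≤-<-trans (skip-≤ lo hi _) (interior-bound k j 2+j<k)

  frame-injectiveOn : ∀ k lo hi e → FrameShape k lo hi e → InjectiveOn k (frame k lo hi e)
  frame-injectiveOn k lo hi e s i j i<k j<k eq with position k i i<k | position k j j<k
  ... | first | first = refl
  ... | first | last j′ y rewrite frame-last k lo hi e j′ y =
    ⊥-elim (firstEntry≢lastEntry e (shape-lo<hi e s) eq)
  ... | first | interior j′ y rewrite frame-interior k lo hi e j′ y =
    ⊥-elim (skip-≢-firstEntry e _ (shape-lo<hi e s) (sym eq))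
  ... | last i′ x | first rewrite frame-last k lo hi e i′ x =
    ⊥-elim (firstEntry≢lastEntry e (shape-lo<hi e s) (sym eq))
  ... | last i′ x | last j′ y = cong suc (+-cancelˡ-≡ 2 i′ j′ (trans x (sym y)))
  ... | last i′ x | interior j′ y rewrite frame-last k lo hi e i′ x | frame-interior k lo hi e j′ y =
    ⊥-elim (skip-≢-lastEntry e _ (shape-lo<hi e s) (sym eq))
  ... | interior i′ x | first rewrite frame-interior k lo hi e i′ x =
    ⊥-elim (skip-≢-firstEntry e _ (shape-lo<hi e s) eq)
  ... | interior i′ x | last j′ y rewrite frame-last k lo hi e j′ y | frame-interior k lo hi e i′ x =
    ⊥-elim (skip-≢-lastEntry e _ (shape-lo<hi e s) eq)
  ... | interior i′ x | interior j′ y rewrite frame-interior k lo hi e i′ x | frame-interior k lo hi e j′ y =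
    cong suc (+-cancelˡ-≡ 3 i′ j′ (∸-cancelˡ-≡ x y (skip-injective lo hi eq)))

  -- The second and third entries of an occurrence would form an ascent inside the decreasing interior.
  frame-avoiding : ∀ k lo hi e → Avoiding k (frame k lo hi e)
  frame-avoiding k lo hi e i zero j′ l () _ _ _ _ _
  frame-avoiding k lo hi e i (suc j) zero l _ () _ _ _ _
  frame-avoiding k lo hi e i (suc j) (suc j′) l i<j j<j′ j′<l l<k fl<fi fj<fj′
    rewrite frame-interior k lo hi e j (<-trans (≤-<-trans j<j′ j′<l) l<k)
          | frame-interior k lo hi e j′ (≤-<-trans j′<l l<k) =
    <-asym (skip-cancel-< lo hi fj<fj′) (∸-monoʳ-< (s≤s (s≤s j<j′)) (≤-<-trans j′<l l<k))

  skip-0 : ∀ {lo hi} → 0 < lo → lo < hi → skip lo hi 0 ≡ 0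
  skip-0 {lo} {hi} 0<lo lo<hi rewrite punchIn-< lo 0 0<lo = punchIn-< hi 0 (<-trans 0<lo lo<hi)

  skip-top : ∀ {lo hi} c → lo < hi → hi ≤ suc c → skip lo hi c ≡ 2 + c
  skip-top {lo} {hi} c lo<hi hi≤1+c
    rewrite punchIn-≥ lo c (s≤s⁻¹ (<-≤-trans lo<hi hi≤1+c)) = punchIn-≥ hi (suc c) hi≤1+c

  frame-descent : ∀ k lo hi e c → 3 + c < k → frame k lo hi e (2 + c) < frame k lo hi e (1 + c)
  frame-descent k lo hi e c 3+c<k
    rewrite frame-interior k lo hi e (suc c) 3+c<k | frame-interior k lo hi e c (<-trans (n<1+n _) 3+c<k) =
    skip-mono-< lo hi (∸-monoʳ-< ≤-refl 3+c<k)

  frame-indecomposable : ∀ k lo hi e → FrameShape k lo hi e → Indecomposable k (frame k lo hi e)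
  frame-indecomposable zero lo hi e s c 0<c ()
  frame-indecomposable (suc zero) lo hi e s c 0<c c<1 = ⊥-elim (<⇒≱ 0<c (s≤s⁻¹ c<1))
  frame-indecomposable (suc (suc k₂)) lo hi highLow (lo<hi , _) c 0<c c<k =
    0 , suc k₂ , 0<c , s≤s⁻¹ c<k , ≤-refl , subst (_< hi) (sym (frame-last _ lo hi highLow k₂ refl)) lo<hi
  frame-indecomposable (suc (suc zero)) lo hi lowHigh (lo<hi , _ , _ , 1+hi<2) c _ _ =
    ⊥-elim (n≮0 (<-≤-trans lo<hi (s≤s⁻¹ (s≤s⁻¹ 1+hi<2))))
  frame-indecomposable k@(suc (suc (suc k₃))) lo hi lowHigh (lo<hi , _ , 0<lo , _) (suc zero) _ _ =
    0 , suc k₃ , z<s , s≤s z≤n , n≤1+n _ , below-lo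
    where
    below-lo : frame k lo hi lowHigh (suc k₃) < lo
    below-lo rewrite frame-interior k lo hi lowHigh k₃ ≤-refl | n∸n≡0 k₃ | skip-0 0<lo lo<hi = 0<lo
  frame-indecomposable k lo hi lowHigh s@(lo<hi , _ , _ , 1+hi<k) (suc (suc c)) _ 2+c<k with 3 + c ≟ k
  ... | no 3+c≢k = suc c , suc (suc c) , ≤-refl , ≤-refl , 2+c<k , frame-descent k lo hi lowHigh c (≤∧≢⇒< 2+c<k 3+c≢k)
  ... | yes refl = 1 , suc (suc c) , s≤s z<s , ≤-refl , ≤-refl , hi<second
    where
    hi≤1+c : hi ≤ suc c
    hi≤1+c = s≤s⁻¹ (s≤s⁻¹ 1+hi<k)
    hi<second : frame k lo hi lowHigh (suc (suc c)) < frame k lo hi lowHigh 1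
    hi<second rewrite frame-last k lo hi lowHigh (suc c) refl | frame-interior k lo hi lowHigh 0 (s≤s (s≤s (s≤s z≤n)))
                    | skip-top c lo<hi hi≤1+c = s≤s hi≤1+c

  -- Blocks and their direct sums

  data Block : Set where
    point : Block
    framed : (k lo hi : ℕ) → Ends → Block

  ValidBlock : Block → Set
  ValidBlock point = ⊤
  ValidBlock (framed k lo hi e) = FrameShape k lo hi e

  size : Block → ℕ
  size point = 1
  size (framed k _ _ _) = k

  blockFun : Block → ℕ → ℕ
  blockFun point _ = 0
  blockFun (framed k lo hi e) = frame k lo hi e

  size-pos : ∀ B → ValidBlock B → 0 < size B
  size-pos point _ = z<s
  size-pos (framed k lo hi e) s = <-≤-trans z<s (<⇒≤ (shape-2≤k e s))

  blockFun-bounded : ∀ B → ValidBlock B → Bounded (size B) (blockFun B)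
  blockFun-bounded point _ i i<1 = z<s
  blockFun-bounded (framed k lo hi e) = frame-bounded k lo hi e

  blockFun-injectiveOn : ∀ B → ValidBlock B → InjectiveOn (size B) (blockFun B)
  blockFun-injectiveOn point _ i j i<1 j<1 _ = trans (n<1⇒n≡0 i<1) (sym (n<1⇒n≡0 j<1))
  blockFun-injectiveOn (framed k lo hi e) = frame-injectiveOn k lo hi e

  blockFun-avoiding : ∀ B → Avoiding (size B) (blockFun B)
  blockFun-avoiding point i j k l _ _ _ _ ()
  blockFun-avoiding (framed k lo hi e) = frame-avoiding k lo hi e

  blockFun-indecomposable : ∀ B → ValidBlock B → Indecomposable (size B) (blockFun B)
  blockFun-indecomposable point _ c 0<c c<1 = ⊥-elim (<⇒≱ 0<c (s≤s⁻¹ c<1))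
  blockFun-indecomposable (framed k lo hi e) = frame-indecomposable k lo hi e

  ends-unique : ∀ k {lo hi lo′ hi′} e e′ → lo < hi → lo′ < hi′ →
                firstEntry e lo hi ≡ firstEntry e′ lo′ hi′ → lastEntry e lo hi ≡ lastEntry e′ lo′ hi′ →
                framed k lo hi e ≡ framed k lo′ hi′ e′
  ends-unique k highLow highLow _ _ refl refl = refl
  ends-unique k lowHigh lowHigh _ _ refl refl = refl
  ends-unique k highLow lowHigh lo<hi lo′<hi′ refl refl = ⊥-elim (<-asym lo<hi lo′<hi′)
  ends-unique k lowHigh highLow lo<hi lo′<hi′ refl refl = ⊥-elim (<-asym lo<hi lo′<hi′)

  blockFun-injective : ∀ B B′ → ValidBlock B → ValidBlock B′ → size B ≡ size B′ →
                       (∀ i → i < size B → blockFun B i ≡ blockFun B′ i) → B ≡ B′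
  blockFun-injective point point _ _ _ _ = refl
  blockFun-injective point (framed _ lo hi e) _ s refl _ = ⊥-elim (<⇒≱ (shape-2≤k e s) ≤-refl)
  blockFun-injective (framed _ lo hi e) point s _ refl _ = ⊥-elim (<⇒≱ (shape-2≤k e s) ≤-refl)
  blockFun-injective (framed zero lo hi e) (framed _ _ _ _) s _ refl _ = ⊥-elim (<⇒≱ (shape-2≤k e s) z≤n)
  blockFun-injective (framed (suc zero) lo hi e) (framed _ _ _ _) s _ refl _ = ⊥-elim (<⇒≱ (shape-2≤k e s) ≤-refl)
  blockFun-injective (framed (suc (suc k₂)) lo hi e) (framed _ lo′ hi′ e′) s s′ refl f≗g =
    ends-unique _ e e′ (shape-lo<hi e s) (shape-lo<hi e′ s′) (f≗g 0 z<s)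
      (begin
        lastEntry e lo hi                      ≡⟨ frame-last _ lo hi e k₂ refl ⟨
        frame (2 + k₂) lo hi e (suc k₂)        ≡⟨ f≗g (suc k₂) ≤-refl ⟩
        frame (2 + k₂) lo′ hi′ e′ (suc k₂)     ≡⟨ frame-last _ lo′ hi′ e′ k₂ refl ⟩
        lastEntry e′ lo′ hi′                   ∎)
    where open ≡-Reasoning

  sumBlocks : List Block → ℕ → ℕ
  sumBlocks [] _ = 0
  sumBlocks (B ∷ bs) = blockFun B ⊕[ size B ] sumBlocks bs

  totalSize : List Block → ℕ
  totalSize bs = sum (map size bs)

  sumBlocks-bounded : ∀ bs → All ValidBlock bs → Bounded (totalSize bs) (sumBlocks bs)
  sumBlocks-bounded [] [] i ()
  sumBlocks-bounded (B ∷ bs) (v ∷ vs) = ⊕-bounded (blockFun-bounded B v) (sumBlocks-bounded bs vs)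

  sumBlocks-injectiveOn : ∀ bs → All ValidBlock bs → InjectiveOn (totalSize bs) (sumBlocks bs)
  sumBlocks-injectiveOn [] [] i j ()
  sumBlocks-injectiveOn (B ∷ bs) (v ∷ vs) =
    ⊕-injectiveOn (blockFun-bounded B v) (blockFun-injectiveOn B v) (sumBlocks-injectiveOn bs vs)

  sumBlocks-avoiding : ∀ bs → All ValidBlock bs → Avoiding (totalSize bs) (sumBlocks bs)
  sumBlocks-avoiding [] [] i j k l i<j j<k k<l ()
  sumBlocks-avoiding (B ∷ bs) (v ∷ vs) =
    ⊕-avoiding (blockFun-bounded B v) (blockFun-avoiding B) (sumBlocks-avoiding bs vs)

  first-size-≤ : ∀ B bs B′ bs′ → ValidBlock B → ValidBlock B′ →
    totalSize (B ∷ bs) ≡ totalSize (B′ ∷ bs′) →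
    (∀ i → i < totalSize (B ∷ bs) → sumBlocks (B ∷ bs) i ≡ sumBlocks (B′ ∷ bs′) i) → size B′ ≤ size B
  first-size-≤ B bs B′ bs′ v v′ n≡n′ f≗g = ≮⇒≥ λ k<k′ →
    indecomposable⇒¬cut (⊕-indecomposable (blockFun-indecomposable B′ v′)) (size-pos B v) k<k′ (m≤m+n _ _)
      (subst (λ n → Cut n (sumBlocks (B′ ∷ bs′)) (size B)) n≡n′
        (cut-resp-≗ f≗g (m≤m+n _ _) (⊕-cut (blockFun-bounded B v))))

  -- The first block is the shortest nonempty prefix that is a cut, hence determined by the sum.
  sumBlocks-injective : ∀ p q → All ValidBlock p → All ValidBlock q → totalSize p ≡ totalSize q →
    (∀ i → i < totalSize p → sumBlocks p i ≡ sumBlocks q i) → p ≡ q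
  sumBlocks-injective [] [] _ _ _ _ = refl
  sumBlocks-injective [] (B ∷ _) _ (v ∷ _) 0≡n _ = ⊥-elim (<-irrefl 0≡n (<-≤-trans (size-pos B v) (m≤m+n _ _)))
  sumBlocks-injective (B ∷ _) [] (v ∷ _) _ n≡0 _ = ⊥-elim (<-irrefl (sym n≡0) (<-≤-trans (size-pos B v) (m≤m+n _ _)))
  sumBlocks-injective (B ∷ bs) (B′ ∷ bs′) (v ∷ vs) (v′ ∷ vs′) n≡n′ f≗g =
    cong₂ _∷_ (blockFun-injective B B′ v v′ k≡k′ heads)
      (sumBlocks-injective bs bs′ vs vs′ (+-cancelˡ-≡ k _ _ (trans n≡n′ (cong (_+ totalSize bs′) (sym k≡k′)))) tails)
    where
    open ≡-Reasoning
    k : ℕ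
    k = size B
    g≗f : ∀ i → i < totalSize (B′ ∷ bs′) → sumBlocks (B′ ∷ bs′) i ≡ sumBlocks (B ∷ bs) i
    g≗f i i<n′ = sym (f≗g i (subst (i <_) (sym n≡n′) i<n′))
    k≡k′ : k ≡ size B′
    k≡k′ = ≤-antisym (first-size-≤ B′ bs′ B bs v′ v (sym n≡n′) g≗f)
                     (first-size-≤ B bs B′ bs′ v v′ n≡n′ f≗g)
    heads : ∀ i → i < k → blockFun B i ≡ blockFun B′ i
    heads i i<k = begin
      blockFun B i                 ≡⟨ ⊕-< (blockFun B) k (sumBlocks bs) i i<k ⟨
      sumBlocks (B ∷ bs) i         ≡⟨ f≗g i (<-≤-trans i<k (m≤m+n _ _)) ⟩
      sumBlocks (B′ ∷ bs′) i       ≡⟨ ⊕-< (blockFun B′) (size B′) (sumBlocks bs′) i (subst (i <_) k≡k′ i<k) ⟩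
      blockFun B′ i                ∎
    tails : ∀ i → i < totalSize bs → sumBlocks bs i ≡ sumBlocks bs′ i
    tails i i<n = +-cancelˡ-≡ k _ _ (begin
      k + sumBlocks bs i                  ≡⟨ ⊕-+ (blockFun B) k (sumBlocks bs) i ⟨
      sumBlocks (B ∷ bs) (k + i)          ≡⟨ f≗g (k + i) (+-monoʳ-< k i<n) ⟩
      sumBlocks (B′ ∷ bs′) (k + i)        ≡⟨ cong (λ c → sumBlocks (B′ ∷ bs′) (c + i)) k≡k′ ⟩
      sumBlocks (B′ ∷ bs′) (size B′ + i)  ≡⟨ ⊕-+ (blockFun B′) (size B′) (sumBlocks bs′) i ⟩
      size B′ + sumBlocks bs′ i           ≡⟨ cong (_+ sumBlocks bs′ i) k≡k′ ⟨
      k + sumBlocks bs′ i                 ∎)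

  -- Indecomposable avoiders are blocks

  Represents : Block → ℕ → (ℕ → ℕ) → Set
  Represents B k α = ValidBlock B × size B ≡ k × (∀ i → i < k → α i ≡ blockFun B i)

  module IndecomposableAvoider
    (k₂ : ℕ) (α : ℕ → ℕ) (bounded : Bounded (2 + k₂) α) (injective : InjectiveOn (2 + k₂) α)
    (avoiding : Avoiding (2 + k₂) α) (indecomposable : Indecomposable (2 + k₂) α) where

    k : ℕ
    k = 2 + k₂

    -- Otherwise i, j, j + 1, l would be an occurrence.
    around-ascent : ∀ i j l → i < j → suc j < l → l < k → α j < α (suc j) → α i < α l
    around-ascent i j l i<j 1+j<l l<k ascent =
      ≮⇒>-injectiveOn α injective l i l<k (<-trans i<l l<k) (λ l≡i → <-irrefl (sym l≡i) i<l)
        (λ αl<αi → avoiding i j (suc j) l i<j (n<1+n j) 1+j<l l<k αl<αi ascent)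
      where
      i<l : i < l
      i<l = <-trans i<j (<-trans (n<1+n j) 1+j<l)

    descent-across-j : ∀ j i l → α j < α (suc j) → i < j → j ≤ l → l < k → α l < α i → α j < α i
    descent-across-j j i l ascent i<j j≤l l<k αl<αi with m≤n⇒m<n∨m≡n j≤l
    ... | inj₂ refl = αl<αi
    ... | inj₁ j<l with m≤n⇒m<n∨m≡n j<l
    ...   | inj₂ refl = <-trans ascent αl<αi
    ...   | inj₁ 1+j<l = ⊥-elim (<-asym αl<αi (around-ascent i j l i<j 1+j<l l<k ascent))

    descent-across-2+j : ∀ j i l → α j < α (suc j) → i < 2 + j → 2 + j ≤ l → l < k → α l < α i →
                         α l < α (suc j)
    descent-across-2+j j i l ascent i<2+j 2+j≤l l<k αl<αi with m<1+n⇒m<n∨m≡n i<2+j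
    ... | inj₂ refl = αl<αi
    ... | inj₁ i<1+j with m<1+n⇒m<n∨m≡n i<1+j
    ...   | inj₂ refl = <-trans αl<αi ascent
    ...   | inj₁ i<j = ⊥-elim (<-asym αl<αi (around-ascent i j l i<j 2+j≤l l<k ascent))

    no-descent-across-1+j : ∀ j i₀ l₁ i l → α j < α (suc j) → i₀ < j → α j < α i₀ →
      2 + j ≤ l₁ → l₁ < k → α l₁ < α (suc j) → i < suc j → suc j ≤ l → l < k → α l < α i → ⊥
    no-descent-across-1+j j i₀ l₁ i l ascent i₀<j αj<αi₀ 2+j≤l₁ l₁<k αl₁<αj+1 i<1+j 1+j≤l l<k αl<αi
      with m<1+n⇒m<n∨m≡n i<1+j | m≤n⇒m<n∨m≡n 1+j≤l
    ... | inj₂ refl | inj₂ refl = <-asym αl<αi ascent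
    ... | inj₂ refl | inj₁ 1+j<l = <-asym αl<αi (<-trans αj<αi₀ (around-ascent i₀ j l i₀<j 1+j<l l<k ascent))
    ... | inj₁ i<j | inj₂ refl = <-asym αl<αi (<-trans (around-ascent i j l₁ i<j 2+j≤l₁ l₁<k ascent) αl₁<αj+1)
    ... | inj₁ i<j | inj₁ 1+j<l = <-asym αl<αi (around-ascent i j l i<j 1+j<l l<k ascent)

    -- An interior ascent at j is impossible: no descent can cross the cut at j + 1
    -- once those crossing the cuts at j and j + 2 are placed.
    interior-descending : ∀ j → 0 < j → 3 + j ≤ k → α (suc j) < α j
    interior-descending j 0<j 3+j≤k with <-cmp (α (suc j)) (α j)
    ... | tri< αj+1<αj _ _ = αj+1<αj
    ... | tri≈ _ αj+1≡αj _ =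
      ⊥-elim (1+n≢n (injective (suc j) j (<-trans (n<1+n _) 3+j≤k) (<-trans (n<1+n j) (<-trans (n<1+n _) 3+j≤k)) αj+1≡αj))
    ... | tri> _ _ ascent
      with indecomposable j 0<j (<-trans (n<1+n j) (<-trans (n<1+n _) 3+j≤k))
         | indecomposable (2 + j) z<s 3+j≤k
         | indecomposable (suc j) z<s (<-trans (n<1+n _) 3+j≤k)
    ... | i₀ , l₀ , i₀<j , j≤l₀ , l₀<k , αl₀<αi₀ | i₁ , l₁ , i₁<2+j , 2+j≤l₁ , l₁<k , αl₁<αi₁
        | i , l , i<1+j , 1+j≤l , l<k , αl<αi =
      ⊥-elim (no-descent-across-1+j j i₀ l₁ i l ascent
                i₀<j (descent-across-j j i₀ l₀ ascent i₀<j j≤l₀ l₀<k αl₀<αi₀)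
                2+j≤l₁ l₁<k (descent-across-2+j j i₁ l₁ ascent i₁<2+j 2+j≤l₁ l₁<k αl₁<αi₁)
                i<1+j 1+j≤l l<k αl<αi)

    -- After punching out lo and hi, the k₂ interior values are distinct, decreasing and
    -- below k₂, so the one at position j is k₂ - j.
    interior-values : ∀ lo hi → lo < hi → hi < k →
      (∀ j → 0 < j → j ≤ k₂ → α j ≢ lo) → (∀ j → 0 < j → j ≤ k₂ → α j ≢ hi) →
      ∀ j → 0 < j → j ≤ k₂ → α j ≡ skip lo hi (k₂ ∸ j)
    interior-values lo hi lo<hi hi<k ≢lo ≢hi j 0<j j≤k₂ =
      trans (sym (skip-τ j 0<j j≤k₂)) (cong (skip lo hi) (τ≡ j 0<j j≤k₂))
      where
      j<k : ∀ {j} → j ≤ k₂ → j < k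
      j<k j≤k₂ = <-trans (s≤s j≤k₂) (n<1+n (suc k₂))
      punchOut-hi-≢-lo : ∀ j → 0 < j → j ≤ k₂ → punchOut hi (α j) ≢ lo
      punchOut-hi-≢-lo j 0<j j≤k₂ eq with α j <? hi
      ... | yes _ = ≢lo j 0<j j≤k₂ eq
      ... | no αj≮hi = <⇒≱ lo<hi (subst (hi ≤_) eq
                         (pred-mono-≤ (≤∧≢⇒< (≮⇒≥ αj≮hi) (λ hi≡αj → ≢hi j 0<j j≤k₂ (sym hi≡αj)))))
      τ : ℕ → ℕ
      τ j = punchOut lo (punchOut hi (α j))
      skip-τ : ∀ j → 0 < j → j ≤ k₂ → skip lo hi (τ j) ≡ α j
      skip-τ j 0<j j≤k₂ = trans (cong (punchIn hi) (punchIn-punchOut lo _ (punchOut-hi-≢-lo j 0<j j≤k₂)))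
                                 (punchIn-punchOut hi _ (≢hi j 0<j j≤k₂))
      τ<k₂ : ∀ j → 0 < j → j ≤ k₂ → τ j < k₂
      τ<k₂ j 0<j j≤k₂ = punchOut-< lo _ k₂ (punchOut-hi-≢-lo j 0<j j≤k₂)
        (punchOut-< hi (α j) (suc k₂) (≢hi j 0<j j≤k₂) (bounded j (j<k j≤k₂)) hi<k)
        (<-≤-trans lo<hi (s≤s⁻¹ hi<k))
      τ-descending : ∀ j → 0 < j → j < k₂ → τ (suc j) < τ j
      τ-descending j 0<j j<k₂ =
        punchOut-mono-< lo (punchOut-hi-≢-lo (suc j) z<s j<k₂) (punchOut-hi-≢-lo j 0<j (<⇒≤ j<k₂))
          (punchOut-mono-< hi (≢hi (suc j) z<s j<k₂) (≢hi j 0<j (<⇒≤ j<k₂))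
            (interior-descending j 0<j (s≤s (s≤s j<k₂))))
      j+τ≤k₂ : ∀ j → 0 < j → j ≤ k₂ → j + τ j ≤ k₂
      j+τ≤k₂ (suc zero) 0<j j≤k₂ = τ<k₂ 1 0<j j≤k₂
      j+τ≤k₂ (suc (suc j)) _ j≤k₂ =
        ≤-trans (+-monoʳ-< (suc j) (τ-descending (suc j) z<s j≤k₂)) (j+τ≤k₂ (suc j) z<s (<⇒≤ j≤k₂))
      k₂≤j+τ : ∀ d j → j + d ≡ k₂ → 0 < j → k₂ ≤ j + τ j
      k₂≤j+τ zero j j+0≡k₂ _ = subst (_≤ j + τ j) (trans (sym (+-identityʳ j)) j+0≡k₂) (m≤m+n j _)
      k₂≤j+τ (suc d) j j+d≡k₂ 0<j =
        ≤-trans (k₂≤j+τ d (suc j) (trans (sym (+-suc j d)) j+d≡k₂) z<s)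
                (+-monoʳ-< j (τ-descending j 0<j (subst (j <_) j+d≡k₂ (m<m+n j z<s))))
      τ≡ : ∀ j → 0 < j → j ≤ k₂ → τ j ≡ k₂ ∸ j
      τ≡ j 0<j j≤k₂ = trans (sym (m+n∸m≡n j (τ j)))
        (cong (_∸ j) (≤-antisym (j+τ≤k₂ j 0<j j≤k₂) (k₂≤j+τ (k₂ ∸ j) j (m+[n∸m]≡n j≤k₂) 0<j)))

    framed-from-ends : ∀ e lo hi → FrameShape k lo hi e → firstEntry e lo hi ≡ α 0 → lastEntry e lo hi ≡ α (suc k₂) →
      (∀ j → 0 < j → j ≤ k₂ → α j ≡ skip lo hi (k₂ ∸ j)) → Represents (framed k lo hi e) k α
    framed-from-ends e lo hi s first≡ last≡ interior≡ = s , refl , agree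
      where
      agree : ∀ i → i < k → α i ≡ frame k lo hi e i
      agree i i<k with position k i i<k
      ... | first = sym first≡
      ... | last j refl = trans (sym last≡) (sym (frame-last k lo hi e j refl))
      ... | interior j 2+j<k = trans (interior≡ (suc j) z<s (s≤s⁻¹ (s≤s⁻¹ 2+j<k))) (sym (frame-interior k lo hi e j 2+j<k))

    -- The cut at 1 forces α 0 > 0 and the cut at k - 1 forces α (k - 1) < k - 1.
    represented : ∃ λ B → Represents B k α
    represented with indecomposable 1 z<s (s≤s z<s) | indecomposable (suc k₂) z<s ≤-refl
    ... | .0 , _ , s≤s z≤n , _ , _ , αl<α0 | i , l , i<1+k₂ , 1+k₂≤l , l<k , αl<αi =
      by-ends (<-cmp (α 0) (α (suc k₂)))
      where
      a b : ℕ
      a = α 0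
      b = α (suc k₂)
      l≡1+k₂ : l ≡ suc k₂
      l≡1+k₂ = ≤-antisym (s≤s⁻¹ l<k) 1+k₂≤l
      1+b<k : suc b < k
      1+b<k = s≤s (<-≤-trans (subst (λ x → α x < α i) l≡1+k₂ αl<αi)
                             (s≤s⁻¹ (bounded i (<-trans i<1+k₂ (n<1+n _)))))
      ≢first : ∀ j → 0 < j → j ≤ k₂ → α j ≢ a
      ≢first j 0<j j≤k₂ eq = <-irrefl (sym (injective j 0 (<-trans (s≤s j≤k₂) (n<1+n _)) z<s eq)) 0<j
      ≢last : ∀ j → 0 < j → j ≤ k₂ → α j ≢ b
      ≢last j 0<j j≤k₂ eq = <-irrefl (injective j (suc k₂) (<-trans (s≤s j≤k₂) (n<1+n _)) (n<1+n _) eq) (s≤s j≤k₂)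
      by-ends : Tri (a < b) (a ≡ b) (b < a) → ∃ λ B → Represents B k α
      by-ends (tri≈ _ a≡b _) = ⊥-elim (0≢1+n (injective 0 (suc k₂) z<s (n<1+n _) a≡b))
      by-ends (tri> _ _ b<a) =
        framed k b a highLow ,
        framed-from-ends highLow b a (b<a , bounded 0 z<s) refl refl
          (interior-values b a b<a (bounded 0 z<s) ≢last ≢first)
      by-ends (tri< a<b _ _) =
        framed k a b lowHigh ,
        framed-from-ends lowHigh a b (a<b , b<k , ≤-<-trans z≤n αl<α0 , 1+b<k) refl refl
          (interior-values a b a<b b<k ≢first ≢last)
        where
        b<k : b < k
        b<k = <-trans (s≤s⁻¹ 1+b<k) (n<1+n _)

  -- Every avoider is a sum of blocks

  Decomposition : ℕ → (ℕ → ℕ) → Set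
  Decomposition n f = ∃ λ p → All ValidBlock p × totalSize p ≡ n × (∀ i → i < n → f i ≡ sumBlocks p i)

  ¬cut⇒crossing : ∀ n f c → ¬ Cut n f c → ∃₂ λ i l → i < c × c ≤ l × l < n × ¬ f i < f l
  ¬cut⇒crossing n f c ¬cut with ¬∀<⇒∃¬ (λ i → ∀<? (λ l → (c ≤? l) →-dec (f i <? f l)) n) c ¬cut
  ... | i , i<c , ¬below with ¬∀<⇒∃¬ (λ l → (c ≤? l) →-dec (f i <? f l)) n ¬below
  ... | l , l<n , ¬above with c ≤? l
  ... | yes c≤l = i , l , i<c , c≤l , l<n , λ fi<fl → ¬above (λ _ → fi<fl)
  ... | no c≰l = ⊥-elim (¬above (λ c≤l → ⊥-elim (c≰l c≤l)))

  indecomposable-represented : ∀ k α → 0 < k → Bounded k α → InjectiveOn k α → Avoiding k α →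
    Indecomposable k α → ∃ λ B → Represents B k α
  indecomposable-represented (suc zero) α _ bounded _ _ _ =
    point , tt , refl , λ { zero _ → n<1⇒n≡0 (bounded 0 z<s) ; (suc _) (s≤s ()) }
  indecomposable-represented (suc (suc k₂)) α _ bounded injective avoiding indecomposable =
    IndecomposableAvoider.represented k₂ α bounded injective avoiding indecomposable

  module LeastCut (k m : ℕ) (f : ℕ → ℕ) (0<k : 0 < k) (bounded : Bounded (k + m) f)
    (injective : InjectiveOn (k + m) f) (avoiding : Avoiding (k + m) f) (cut : Cut (k + m) f k)
    (minimal : ∀ c → 0 < c → c < k → ¬ Cut (k + m) f c) where

    n : ℕ
    n = k + m

    k+x<n : ∀ {x} → x < m → k + x < n
    k+x<n = +-monoʳ-< k

    -- Pigeonhole: the k values before the cut are distinct and below each later value.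
    suffix-≥k : ∀ x → x < m → k ≤ f (k + x)
    suffix-≥k x x<m = injectiveOn⇒≤ k (f (k + x)) f (λ i i<k → cut i i<k (k + x) (k+x<n x<m) (m≤m+n k x))
                        (injectiveOn-≤ (m≤m+n k m) injective)

    -- Pigeonhole: the m values after the cut are distinct and lie in (f i, n).
    prefix-<k : ∀ i → i < k → f i < k
    prefix-<k i i<k = +-cancelʳ-≤ m (suc (f i)) k (begin
      suc (f i) + m             ≡⟨ +-comm (suc (f i)) m ⟩
      m + suc (f i)             ≤⟨ +-monoˡ-≤ (suc (f i)) m≤n∸fi ⟩
      n ∸ suc (f i) + suc (f i) ≡⟨ m∸n+n≡m fi<n ⟩
      k + m                     ∎)
      where
      open ≤-Reasoning
      fi<n : f i < n
      fi<n = bounded i (<-≤-trans i<k (m≤m+n k m))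
      above : ∀ x → x < m → suc (f i) ≤ f (k + x)
      above x x<m = cut i i<k (k + x) (k+x<n x<m) (m≤m+n k x)
      m≤n∸fi : m ≤ n ∸ suc (f i)
      m≤n∸fi = injectiveOn⇒≤ m (n ∸ suc (f i)) (λ x → f (k + x) ∸ suc (f i))
        (λ x x<m → ∸-monoˡ-< (bounded (k + x) (k+x<n x<m)) (above x x<m))
        (λ x y x<m y<m eq → +-cancelˡ-≡ k _ _
          (injective (k + x) (k + y) (k+x<n x<m) (k+x<n y<m) (∸-cancelʳ-≡ (above x x<m) (above y y<m) eq)))

    prefix-indecomposable : Indecomposable k f
    prefix-indecomposable c 0<c c<k with ¬cut⇒crossing n f c (minimal c 0<c c<k)
    ... | i , l , i<c , c≤l , l<n , fi≮fl = i , l , i<c , c≤l , l<k , fl<fi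
      where
      fl<fi : f l < f i
      fl<fi = ≮⇒>-injectiveOn f injective i l (<-trans i<c (<-≤-trans c<k (m≤m+n k m))) l<n
                (λ i≡l → <⇒≱ i<c (subst (c ≤_) (sym i≡l) c≤l)) fi≮fl
      l<k : l < k
      l<k with l <? k
      ... | yes l<k = l<k
      ... | no l≮k = ⊥-elim (fi≮fl (cut i (<-trans i<c c<k) l l<n (≮⇒≥ l≮k)))

    suffix : ℕ → ℕ
    suffix x = f (k + x) ∸ k

    suffix-bounded : Bounded m suffix
    suffix-bounded x x<m = subst (suffix x <_) (m+n∸m≡n k m) (∸-monoˡ-< (bounded (k + x) (k+x<n x<m)) (suffix-≥k x x<m))

    suffix-injectiveOn : InjectiveOn m suffix
    suffix-injectiveOn x y x<m y<m eq = +-cancelˡ-≡ k _ _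
      (injective (k + x) (k + y) (k+x<n x<m) (k+x<n y<m) (∸-cancelʳ-≡ (suffix-≥k x x<m) (suffix-≥k y y<m) eq))

    suffix-cancel-< : ∀ x y → x < m → y < m → suffix x < suffix y → f (k + x) < f (k + y)
    suffix-cancel-< x y x<m y<m lt =
      subst₂ _<_ (m∸n+n≡m (suffix-≥k x x<m)) (m∸n+n≡m (suffix-≥k y y<m)) (+-monoˡ-< k lt)

    suffix-avoiding : Avoiding m suffix
    suffix-avoiding i j k′ l i<j j<k′ k′<l l<m sl<si sj<sk′ =
      avoiding (k + i) (k + j) (k + k′) (k + l) (+-monoʳ-< k i<j) (+-monoʳ-< k j<k′) (+-monoʳ-< k k′<l) (k+x<n l<m)
        (suffix-cancel-< l i l<m (<-trans i<j (<-trans j<k′ (<-trans k′<l l<m))) sl<si)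
        (suffix-cancel-< j k′ (<-trans j<k′ (<-trans k′<l l<m)) (<-trans k′<l l<m) sj<sk′)

    decomposition : Decomposition m suffix → Decomposition n f
    decomposition (q , valid-q , size-q , f≗q) with indecomposable-represented k f 0<k prefix-<k
      (injectiveOn-≤ (m≤m+n k m) injective) (avoiding-≤ (m≤m+n k m) avoiding) prefix-indecomposable
    ... | B , valid-B , refl , f≗B = B ∷ q , valid-B ∷ valid-q , cong (size B +_) size-q , agree
      where
      agree : ∀ i → i < n → f i ≡ sumBlocks (B ∷ q) i
      agree i i<n with splitAt (size B) i
      ... | left i<k = trans (f≗B i i<k) (sym (⊕-< (blockFun B) (size B) (sumBlocks q) i i<k))
      ... | right x = begin
        f (size B + x)                ≡⟨ m+[n∸m]≡n (suffix-≥k x x<m) ⟨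
        size B + suffix x             ≡⟨ cong (size B +_) (f≗q x x<m) ⟩
        size B + sumBlocks q x        ≡⟨ ⊕-+ (blockFun B) (size B) (sumBlocks q) x ⟨
        sumBlocks (B ∷ q) (size B + x) ∎
        where
        open ≡-Reasoning
        x<m : x < m
        x<m = +-cancelˡ-< (size B) x m i<n

  Decomposable : ℕ → Set
  Decomposable n = ∀ f → Bounded n f → InjectiveOn n f → Avoiding n f → Decomposition n f

  -- Split off the block before the least positive cut and recurse on the rest.
  decomposable-step : ∀ n → (∀ {n′} → n′ < n → Decomposable n′) → Decomposable n
  decomposable-step zero _ f _ _ _ = [] , [] , refl , λ _ ()
  decomposable-step (suc n) rec f bounded injective avoiding
    with least (λ c → cut? (suc n) f (suc c)) n (λ _ _ l l<1+n 1+n≤l → ⊥-elim (<⇒≱ l<1+n 1+n≤l))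
  ... | c , c≤n , cut , minimal with m≤n⇒∃[o]m+o≡n c≤n
  ... | m , refl = decomposition (rec (s≤s (m≤n+m m c)) suffix suffix-bounded suffix-injectiveOn suffix-avoiding)
    where
    minimal′ : ∀ c′ → 0 < c′ → c′ < suc c → ¬ Cut (suc c + m) f c′
    minimal′ (suc c′) _ 1+c′<1+c = minimal c′ (s≤s⁻¹ 1+c′<1+c)
    open LeastCut (suc c) m f z<s bounded injective avoiding cut minimal′

  decomposable : ∀ n → Decomposable n
  decomposable = <-rec Decomposable decomposable-step


  -- Listing the decompositions

  concatBelow : ∀ {X : Set} → ℕ → (ℕ → List X) → List X
  concatBelow zero g = []
  concatBelow (suc n) g = concatBelow n g ++ g n

  sumBelow : ℕ → (ℕ → ℕ) → ℕ
  sumBelow zero h = 0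
  sumBelow (suc n) h = sumBelow n h + h n

  sumBelow-cong : ∀ n {h h′ : ℕ → ℕ} → (∀ r → r < n → h r ≡ h′ r) → sumBelow n h ≡ sumBelow n h′
  sumBelow-cong zero _ = refl
  sumBelow-cong (suc n) h≗h′ = cong₂ _+_ (sumBelow-cong n (λ r r<n → h≗h′ r (m<n⇒m<1+n r<n))) (h≗h′ n ≤-refl)

  module _ {X : Set} where

    length-concatBelow : ∀ n (g : ℕ → List X) → length (concatBelow n g) ≡ sumBelow n (λ r → length (g r))
    length-concatBelow zero g = refl
    length-concatBelow (suc n) g = trans (length-++ (concatBelow n g)) (cong (_+ length (g n)) (length-concatBelow n g))

    ∈-concatBelow⁺ : ∀ n (g : ℕ → List X) {x} r → r < n → x ∈ g r → x ∈ concatBelow n g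
    ∈-concatBelow⁺ (suc n) g r r<1+n x∈gr with m<1+n⇒m<n∨m≡n r<1+n
    ... | inj₁ r<n = ∈-++⁺ˡ (∈-concatBelow⁺ n g r r<n x∈gr)
    ... | inj₂ refl = ∈-++⁺ʳ (concatBelow n g) x∈gr

    ∈-concatBelow⁻ : ∀ n (g : ℕ → List X) {x} → x ∈ concatBelow n g → ∃ λ r → r < n × x ∈ g r
    ∈-concatBelow⁻ (suc n) g x∈ with ∈-++⁻ (concatBelow n g) x∈
    ... | inj₁ x∈′ = let r , r<n , x∈gr = ∈-concatBelow⁻ n g x∈′ in r , m<n⇒m<1+n r<n , x∈gr
    ... | inj₂ x∈gn = n , ≤-refl , x∈gn

    -- The label φ tells which g r an element comes from, so distinct r contribute disjoint lists.
    concatBelow-unique : ∀ n (g : ℕ → List X) (φ : X → ℕ) → (∀ r x → r < n → x ∈ g r → φ x ≡ r) →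
      (∀ r → r < n → Unique (g r)) → Unique (concatBelow n g)
    concatBelow-unique zero g φ label unique = []
    concatBelow-unique (suc n) g φ label unique =
      Uniqueₚ.++⁺ (concatBelow-unique n g φ (λ r x r<n → label r x (m<n⇒m<1+n r<n))
                                            (λ r r<n → unique r (m<n⇒m<1+n r<n)))
        (unique n ≤-refl) disjoint
      where
      disjoint : ∀ {x} → ¬ (x ∈ concatBelow n g × x ∈ g n)
      disjoint (x∈ , x∈gn) with ∈-concatBelow⁻ n g x∈
      ... | r , r<n , x∈gr = <-irrefl (trans (sym (label r _ (m<n⇒m<1+n r<n) x∈gr)) (label n _ ≤-refl x∈gn)) r<n

    concatBelow-cong : ∀ n {g g′ : ℕ → List X} → (∀ r → r < n → g r ≡ g′ r) →
                       concatBelow n g ≡ concatBelow n g′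
    concatBelow-cong zero _ = refl
    concatBelow-cong (suc n) g≗g′ =
      cong₂ _++_ (concatBelow-cong n (λ r r<n → g≗g′ r (m<n⇒m<1+n r<n))) (g≗g′ n ≤-refl)

  length-cartesianProductWith : ∀ {A B C : Set} (f : A → B → C) xs ys →
    length (cartesianProductWith f xs ys) ≡ length xs * length ys
  length-cartesianProductWith f [] ys = refl
  length-cartesianProductWith f (x ∷ xs) ys =
    trans (length-++ (map (f x) ys)) (cong₂ _+_ (length-map (f x) ys) (length-cartesianProductWith f xs ys))

  highLowFrames : ℕ → List Block
  highLowFrames k = concatBelow k (λ hi → applyUpTo (λ lo → framed k lo hi highLow) hi)

  lowHighFrames : ℕ → List Block
  lowHighFrames k = concatBelow (pred k) (λ hi → applyUpTo (λ l → framed k (suc l) hi lowHigh) (pred hi))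

  blocksOfSize : ℕ → List Block
  blocksOfSize zero = []
  blocksOfSize (suc zero) = point ∷ []
  blocksOfSize k@(suc (suc _)) = highLowFrames k ++ lowHighFrames k

  ∈-highLowFrames⁻ : ∀ k {B} → B ∈ highLowFrames k → ∃₂ λ lo hi → B ≡ framed k lo hi highLow × lo < hi × hi < k
  ∈-highLowFrames⁻ k B∈ with ∈-concatBelow⁻ k _ B∈
  ... | hi , hi<k , B∈′ with ∈-applyUpTo⁻ _ B∈′
  ... | lo , lo<hi , B≡ = lo , hi , B≡ , lo<hi , hi<k

  ∈-lowHighFrames⁻ : ∀ k {B} → B ∈ lowHighFrames k →
    ∃₂ λ l hi → B ≡ framed k (suc l) hi lowHigh × suc l < hi × suc hi < k
  ∈-lowHighFrames⁻ (suc k) B∈ with ∈-concatBelow⁻ k _ B∈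
  ... | suc hi , hi<k , B∈′ with ∈-applyUpTo⁻ _ B∈′
  ... | l , l<hi , B≡ = l , suc hi , B≡ , s≤s l<hi , s≤s hi<k

  blocksOfSize-sound : ∀ k {B} → B ∈ blocksOfSize k → ValidBlock B × size B ≡ k
  blocksOfSize-sound (suc zero) (here refl) = tt , refl
  blocksOfSize-sound k@(suc (suc _)) B∈ with ∈-++⁻ (highLowFrames k) B∈
  ... | inj₁ B∈′ with ∈-highLowFrames⁻ k B∈′
  ...   | lo , hi , refl , lo<hi , hi<k = (lo<hi , hi<k) , refl
  blocksOfSize-sound k@(suc (suc _)) B∈ | inj₂ B∈′ with ∈-lowHighFrames⁻ k B∈′
  ...   | l , hi , refl , 1+l<hi , 1+hi<k = (1+l<hi , <-trans (n<1+n hi) 1+hi<k , z<s , 1+hi<k) , refl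

  blocksOfSize-complete : ∀ B → ValidBlock B → B ∈ blocksOfSize (size B)
  blocksOfSize-complete point _ = here refl
  blocksOfSize-complete (framed zero lo hi e) s = ⊥-elim (<⇒≱ (shape-2≤k e s) z≤n)
  blocksOfSize-complete (framed (suc zero) lo hi e) s = ⊥-elim (<⇒≱ (shape-2≤k e s) ≤-refl)
  blocksOfSize-complete (framed (suc (suc _)) lo hi highLow) (lo<hi , hi<k) =
    ∈-++⁺ˡ (∈-concatBelow⁺ _ _ hi hi<k (∈-applyUpTo⁺ _ lo<hi))
  blocksOfSize-complete (framed k@(suc (suc _)) (suc l) (suc h) lowHigh) (1+l<1+h , _ , _ , 2+h<k) =
    ∈-++⁺ʳ (highLowFrames k) (∈-concatBelow⁺ _ _ (suc h) (s≤s⁻¹ 2+h<k) (∈-applyUpTo⁺ _ (s≤s⁻¹ 1+l<1+h)))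
  blocksOfSize-complete (framed (suc (suc _)) zero _ lowHigh) (_ , _ , () , _)
  blocksOfSize-complete (framed (suc (suc _)) (suc _) zero lowHigh) (() , _)

  blocksOfSize-unique : ∀ k → Unique (blocksOfSize k)
  blocksOfSize-unique zero = []
  blocksOfSize-unique (suc zero) = [] ∷ []
  blocksOfSize-unique k@(suc (suc k₂)) = Uniqueₚ.++⁺
    (concatBelow-unique k _ top (λ { hi B _ B∈ → let _ , B≡ = proj₂ (∈-applyUpTo⁻ _ B∈) in cong top B≡ })
      (λ hi _ → Uniqueₚ.applyUpTo⁺₁ _ hi (λ { i<j _ refl → <-irrefl refl i<j })))
    (concatBelow-unique (suc k₂) _ top (λ { hi B _ B∈ → let _ , B≡ = proj₂ (∈-applyUpTo⁻ _ B∈) in cong top B≡ })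
      (λ hi _ → Uniqueₚ.applyUpTo⁺₁ _ (pred hi) (λ { i<j _ refl → <-irrefl refl i<j })))
    λ (B∈ , B∈′) → let _ , _ , B≡ , _ = ∈-highLowFrames⁻ k B∈
                       _ , _ , B≡′ , _ = ∈-lowHighFrames⁻ k B∈′
                    in highLow≢lowHigh (trans (sym B≡) B≡′)
    where
    top : Block → ℕ
    top point = 0
    top (framed _ _ hi _) = hi
    highLow≢lowHigh : ∀ {lo hi lo′ hi′} → framed k lo hi highLow ≢ framed k lo′ hi′ lowHigh
    highLow≢lowHigh ()

  blockCount : ℕ → ℕ
  blockCount zero = 0
  blockCount (suc j) = j * pred j + 1

  sumBelow-id-pred : ∀ j → sumBelow (2 + j) id + sumBelow (suc j) pred ≡ suc j * j + 1
  sumBelow-id-pred zero = refl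
  sumBelow-id-pred (suc j) = begin
    (S + (2 + j)) + (P + j)         ≡⟨ rearrange S P j ⟩
    (S + P) + (2 + j) + j           ≡⟨ cong (λ x → x + (2 + j) + j) (sumBelow-id-pred j) ⟩
    (suc j * j + 1) + (2 + j) + j   ≡⟨ expand j ⟩
    (2 + j) * suc j + 1             ∎
    where
    open ≡-Reasoning
    S P : ℕ
    S = sumBelow (2 + j) id
    P = sumBelow (suc j) pred
    rearrange : ∀ a b j → (a + (2 + j)) + (b + j) ≡ (a + b) + (2 + j) + j
    rearrange = solve-∀
    expand : ∀ j → (suc j * j + 1) + (2 + j) + j ≡ (2 + j) * suc j + 1
    expand = solve-∀

  length-blocksOfSize : ∀ k → length (blocksOfSize k) ≡ blockCount k
  length-blocksOfSize zero = refl
  length-blocksOfSize (suc zero) = refl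
  length-blocksOfSize k@(suc (suc j)) = begin
    length (highLowFrames k ++ lowHighFrames k)             ≡⟨ length-++ (highLowFrames k) ⟩
    length (highLowFrames k) + length (lowHighFrames k)     ≡⟨ cong₂ _+_
      (trans (length-concatBelow k _) (sumBelow-cong k (λ hi _ → length-applyUpTo _ hi)))
      (trans (length-concatBelow (suc j) _) (sumBelow-cong (suc j) (λ hi _ → length-applyUpTo _ (pred hi)))) ⟩
    sumBelow k id + sumBelow (suc j) pred                   ≡⟨ sumBelow-id-pred j ⟩
    blockCount k                                            ∎
    where open ≡-Reasoning

  -- Decompositions of total size n whose first block has size n - r, by recursion on a size bound.
  decompositions : ℕ → ℕ → List (List Block)
  decompositions _ zero = [] ∷ []
  decompositions zero (suc n) = []
  decompositions (suc bound) (suc n) =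
    concatBelow (suc n) (λ r → cartesianProductWith _∷_ (blocksOfSize (suc (n ∸ r))) (decompositions bound r))

  decompositions-sound : ∀ bound n {p} → p ∈ decompositions bound n → All ValidBlock p × totalSize p ≡ n
  decompositions-sound _ zero (here refl) = [] , refl
  decompositions-sound (suc bound) (suc n) p∈ with ∈-concatBelow⁻ (suc n) _ p∈
  ... | r , r<1+n , p∈′ with ∈-cartesianProductWith⁻ _∷_ (blocksOfSize (suc (n ∸ r))) (decompositions bound r) p∈′
  ... | B , q , B∈ , q∈ , refl with blocksOfSize-sound _ B∈ | decompositions-sound bound r q∈
  ... | valid-B , size-B | valid-q , size-q =
    valid-B ∷ valid-q , trans (cong₂ _+_ size-B size-q) (cong suc (m∸n+n≡m (s≤s⁻¹ r<1+n)))

  decompositions-complete : ∀ bound n p → All ValidBlock p → totalSize p ≡ n → n ≤ bound → p ∈ decompositions bound n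
  decompositions-complete _ zero [] _ _ _ = here refl
  decompositions-complete _ zero (B ∷ _) (v ∷ _) n≡0 _ =
    ⊥-elim (<-irrefl (sym n≡0) (<-≤-trans (size-pos B v) (m≤m+n _ _)))
  decompositions-complete (suc bound) (suc n) (B ∷ q) (v ∷ vs) size≡ (s≤s n≤bound)
    with size B | size-pos B v | blocksOfSize-complete B v
  ... | suc s | _ | B∈ =
    ∈-concatBelow⁺ (suc n) _ (totalSize q) (s≤s q≤n)
      (∈-cartesianProductWith⁺ _∷_ (subst (λ x → B ∈ blocksOfSize (suc x)) s≡n∸q B∈)
        (decompositions-complete bound (totalSize q) q vs refl (≤-trans q≤n n≤bound)))
    where
    s+q≡n : s + totalSize q ≡ n
    s+q≡n = suc-injective size≡
    q≤n : totalSize q ≤ n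
    q≤n = subst (totalSize q ≤_) s+q≡n (m≤n+m _ s)
    s≡n∸q : s ≡ n ∸ totalSize q
    s≡n∸q = sym (trans (cong (_∸ totalSize q) (sym s+q≡n)) (m+n∸n≡m s (totalSize q)))

  decompositions-unique : ∀ bound n → Unique (decompositions bound n)
  decompositions-unique _ zero = [] ∷ []
  decompositions-unique zero (suc n) = []
  decompositions-unique (suc bound) (suc n) = concatBelow-unique (suc n) _ tailSize
    (λ r p _ p∈ → let _ , q , _ , q∈ , p≡ = ∈-cartesianProductWith⁻ _∷_ (blocksOfSize (suc (n ∸ r))) _ p∈
                   in trans (cong tailSize p≡) (proj₂ (decompositions-sound bound r q∈)))
    (λ r _ → Uniqueₚ.cartesianProductWith⁺ _∷_ ∷-injective
               (blocksOfSize-unique (suc (n ∸ r))) (decompositions-unique bound r))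
    where
    tailSize : List Block → ℕ
    tailSize [] = 0
    tailSize (_ ∷ q) = totalSize q

  decompositions-bound : ∀ b b′ n → n ≤ b → n ≤ b′ → decompositions b n ≡ decompositions b′ n
  decompositions-bound _ _ zero _ _ = refl
  decompositions-bound (suc b) (suc b′) (suc n) (s≤s n≤b) (s≤s n≤b′) = concatBelow-cong (suc n) λ r r<1+n →
    cong (cartesianProductWith _∷_ (blocksOfSize (suc (n ∸ r))))
      (decompositions-bound b b′ r (≤-trans (s≤s⁻¹ r<1+n) n≤b) (≤-trans (s≤s⁻¹ r<1+n) n≤b′))

  count : ℕ → ℕ
  count n = length (decompositions n n)

  count-convolution : ∀ n → count (suc n) ≡ sumBelow (suc n) (λ r → blockCount (suc (n ∸ r)) * count r)
  count-convolution n = trans (length-concatBelow (suc n) _) (sumBelow-cong (suc n) λ r r<1+n →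
    trans (length-cartesianProductWith _∷_ (blocksOfSize (suc (n ∸ r))) (decompositions n r))
      (cong₂ _*_ (length-blocksOfSize (suc (n ∸ r)))
        (cong length (decompositions-bound n r r (s≤s⁻¹ r<1+n) ≤-refl))))

  unique-lookup-injective : ∀ {A : Set} {xs : List A} → Unique xs → ∀ i j → List.lookup xs i ≡ List.lookup xs j → i ≡ j
  unique-lookup-injective (_ ∷ _) zero zero _ = refl
  unique-lookup-injective (x∉ ∷ _) zero (suc j) eq = ⊥-elim (All.lookup x∉ (∈-lookup j) eq)
  unique-lookup-injective (x∉ ∷ _) (suc i) zero eq = ⊥-elim (All.lookup x∉ (∈-lookup i) (sym eq))
  unique-lookup-injective (_ ∷ u) (suc i) (suc j) eq = cong suc (unique-lookup-injective u i j eq)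

  unique-⊆⇒length-≤ : ∀ {A : Set} {xs ys : List A} → Unique xs → (∀ {x} → x ∈ xs → x ∈ ys) →
                      length xs ≤ length ys
  unique-⊆⇒length-≤ {xs = xs} u xs⊆ys = injective⇒≤ {f = λ i → index (xs⊆ys (∈-lookup i))} λ {i} {j} eq →
    unique-lookup-injective u i j (SetoidMembership.index-injective (setoid _) (xs⊆ys (∈-lookup i)) (xs⊆ys (∈-lookup j)) eq)

  numAvoiders-unique : ∀ {k} (p : POP k) n {m m′} → NumAvoiders p n m → NumAvoiders p n m′ → m ≡ m′
  numAvoiders-unique p n (L , uL , ∈L , refl) (L′ , uL′ , ∈L′ , refl) =
    ≤-antisym (unique-⊆⇒length-≤ uL (λ {π} π∈L → Equivalence.from (∈L′ π) (Equivalence.to (∈L π) π∈L)))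
              (unique-⊆⇒length-≤ uL′ (λ {π} π∈L′ → Equivalence.from (∈L π) (Equivalence.to (∈L′ π) π∈L′)))

  -- Words as functions

  toFun : ∀ {n m} → Vec (Fin n) m → ℕ → ℕ
  toFun [] _ = 0
  toFun (x ∷ _) zero = toℕ x
  toFun (_ ∷ xs) (suc i) = toFun xs i

  toFun-lookup : ∀ {n m} (v : Vec (Fin n) m) (j : Fin m) → toFun v (toℕ j) ≡ toℕ (lookup v j)
  toFun-lookup (x ∷ xs) zero = refl
  toFun-lookup (x ∷ xs) (suc j) = toFun-lookup xs j

  toFun-fromℕ< : ∀ {n m} (v : Vec (Fin n) m) i (i<m : i < m) → toFun v i ≡ toℕ (lookup v (fromℕ< i<m))
  toFun-fromℕ< v i i<m = trans (cong (toFun v) (sym (toℕ-fromℕ< i<m))) (toFun-lookup v (fromℕ< i<m))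

  toFun-bounded : ∀ {n} (π : Word n) → Bounded n (toFun π)
  toFun-bounded π i i<n = subst (_< _) (sym (toFun-fromℕ< π i i<n)) (toℕ<n _)

  -- Out-of-range values are replaced by an arbitrary letter; they never occur for bounded f.
  clamp : ∀ {n} → Fin n → ℕ → Fin n
  clamp {n} j v with v <? n
  ... | yes v<n = fromℕ< v<n
  ... | no _ = j

  toℕ-clamp : ∀ {n} (j : Fin n) v → v < n → toℕ (clamp j v) ≡ v
  toℕ-clamp {n} j v v<n with v <? n
  ... | yes v<n′ = toℕ-fromℕ< v<n′
  ... | no v≮n = ⊥-elim (v≮n v<n)

  fromFun : ∀ n → (ℕ → ℕ) → Word n
  fromFun n f = tabulate (λ j → clamp j (f (toℕ j)))

  toFun-fromFun : ∀ n f → Bounded n f → ∀ i → i < n → toFun (fromFun n f) i ≡ f i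
  toFun-fromFun n f bounded i i<n = begin
    toFun (fromFun n f) i                         ≡⟨ toFun-fromℕ< (fromFun n f) i i<n ⟩
    toℕ (lookup (fromFun n f) (fromℕ< i<n))       ≡⟨ cong toℕ (lookup∘tabulate _ (fromℕ< i<n)) ⟩
    toℕ (clamp _ (f (toℕ (fromℕ< i<n))))          ≡⟨ toℕ-clamp _ _ (bounded _ (toℕ<n (fromℕ< i<n))) ⟩
    f (toℕ (fromℕ< i<n))                          ≡⟨ cong f (toℕ-fromℕ< i<n) ⟩
    f i                                           ∎
    where open ≡-Reasoning

  fromFun-toFun : ∀ {n} (π : Word n) → fromFun n (toFun π) ≡ π
  fromFun-toFun π = trans (tabulate-cong λ j → toℕ-injective
    (trans (toℕ-clamp j _ (subst (_< _) (sym (toFun-lookup π j)) (toℕ<n _))) (toFun-lookup π j))) (tabulate∘lookup π)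

  fromFun-cong : ∀ n {f g} → (∀ i → i < n → f i ≡ g i) → fromFun n f ≡ fromFun n g
  fromFun-cong n f≗g = tabulate-cong λ j → cong (clamp j) (f≗g (toℕ j) (toℕ<n j))

  isPerm⇒injectiveOn : ∀ {n} (π : Word n) → IsPerm π → InjectiveOn n (toFun π)
  isPerm⇒injectiveOn π perm i j i<n j<n eq = begin
    i                     ≡⟨ toℕ-fromℕ< i<n ⟨
    toℕ (fromℕ< i<n)      ≡⟨ cong toℕ (perm _ _ (toℕ-injective
                               (trans (sym (toFun-fromℕ< π i i<n)) (trans eq (toFun-fromℕ< π j j<n))))) ⟩
    toℕ (fromℕ< j<n)      ≡⟨ toℕ-fromℕ< j<n ⟩
    j                     ∎
    where open ≡-Reasoning

  injectiveOn⇒isPerm : ∀ {n} (π : Word n) → InjectiveOn n (toFun π) → IsPerm π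
  injectiveOn⇒isPerm π injective a b eq = toℕ-injective (injective (toℕ a) (toℕ b) (toℕ<n a) (toℕ<n b)
    (trans (toFun-lookup π a) (trans (cong toℕ eq) (sym (toFun-lookup π b)))))

  avoids⇒avoiding : ∀ {n} (π : Word n) → Avoids pat π → Avoiding n (toFun π)
  avoids⇒avoiding {n} π avoids i j k l i<j j<k k<l l<n πl<πi πj<πk = avoids (ι , increasing , related)
    where
    k<n : k < n
    k<n = <-trans k<l l<n
    j<n : j < n
    j<n = <-trans j<k k<n
    i<n : i < n
    i<n = <-trans i<j j<n
    pos : Fin 4 → ℕ
    pos zero = i
    pos (suc zero) = j
    pos (suc (suc zero)) = k
    pos (suc (suc (suc zero))) = l
    pos<n : ∀ a → pos a < n
    pos<n zero = i<n
    pos<n (suc zero) = j<n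
    pos<n (suc (suc zero)) = k<n
    pos<n (suc (suc (suc zero))) = l<n
    ι : Fin 4 → Fin n
    ι a = fromℕ< (pos<n a)
    pos-mono : ∀ a b → a Fin.< b → pos a < pos b
    pos-mono zero (suc zero) _ = i<j
    pos-mono zero (suc (suc zero)) _ = <-trans i<j j<k
    pos-mono zero (suc (suc (suc zero))) _ = <-trans i<j (<-trans j<k k<l)
    pos-mono (suc zero) (suc (suc zero)) _ = j<k
    pos-mono (suc zero) (suc (suc (suc zero))) _ = <-trans j<k k<l
    pos-mono (suc (suc zero)) (suc (suc (suc zero))) _ = k<l
    pos-mono _ zero ()
    pos-mono (suc _) (suc zero) (s≤s ())
    pos-mono (suc (suc _)) (suc (suc zero)) (s≤s (s≤s ()))
    pos-mono (suc (suc (suc _))) (suc (suc (suc zero))) (s≤s (s≤s (s≤s ())))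
    increasing : ∀ a b → a Fin.< b → ι a Fin.< ι b
    increasing a b a<b =
      subst₂ _<_ (sym (toℕ-fromℕ< (pos<n a))) (sym (toℕ-fromℕ< (pos<n b))) (pos-mono a b a<b)
    related : ∀ a b → Rel a b → lookup π (ι a) Fin.< lookup π (ι b)
    related _ _ 4<1 = subst₂ _<_ (toFun-fromℕ< π l l<n) (toFun-fromℕ< π i i<n) πl<πi
    related _ _ 2<3 = subst₂ _<_ (toFun-fromℕ< π j j<n) (toFun-fromℕ< π k k<n) πj<πk

  avoiding⇒avoids : ∀ {n} (π : Word n) → Avoiding n (toFun π) → Avoids pat π
  avoiding⇒avoids π avoiding (ι , increasing , related) =
    avoiding (toℕ (ι zero)) (toℕ (ι (suc zero))) (toℕ (ι (suc (suc zero)))) (toℕ (ι (suc (suc (suc zero)))))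
      (increasing _ _ (s≤s z≤n)) (increasing _ _ (s≤s (s≤s z≤n))) (increasing _ _ (s≤s (s≤s (s≤s z≤n)))) (toℕ<n _)
      (subst₂ _<_ (sym (toFun-lookup π _)) (sym (toFun-lookup π _)) (related _ _ 4<1))
      (subst₂ _<_ (sym (toFun-lookup π _)) (sym (toFun-lookup π _)) (related _ _ 2<3))

  map-unique-on : ∀ {X Y : Set} (f : X → Y) {xs} → Unique xs →
    (∀ {x y} → x ∈ xs → y ∈ xs → f x ≡ f y → x ≡ y) → Unique (map f xs)
  map-unique-on f [] _ = []
  map-unique-on f {x ∷ xs} (x∉ ∷ u) injective =
    fx∉ xs x∉ (λ y∈ → injective (here refl) (there y∈)) ∷
    map-unique-on f u (λ x∈ y∈ → injective (there x∈) (there y∈))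
    where
    fx∉ : ∀ ys → All (x ≢_) ys → (∀ {y} → y ∈ ys → f x ≡ f y → x ≡ y) → All (f x ≢_) (map f ys)
    fx∉ [] [] _ = []
    fx∉ (y ∷ ys) (x≢y ∷ x∉ys) inj =
      (λ fx≡fy → x≢y (inj (here refl) fx≡fy)) ∷ fx∉ ys x∉ys (λ y∈ → inj (there y∈))

  wordOf : ∀ n → List Block → Word n
  wordOf n p = fromFun n (sumBlocks p)

  avoiders : ∀ n → List (Word n)
  avoiders n = map (wordOf n) (decompositions n n)

  module _ {n p} (p∈ : p ∈ decompositions n n) where
    private
      valid : All ValidBlock p
      valid = proj₁ (decompositions-sound n n p∈)
      size≡ : totalSize p ≡ n
      size≡ = proj₂ (decompositions-sound n n p∈)

    sumBlocks-bounded′ : Bounded n (sumBlocks p)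
    sumBlocks-bounded′ = subst (λ m → Bounded m (sumBlocks p)) size≡ (sumBlocks-bounded p valid)

    wordOf-toFun : ∀ i → i < n → sumBlocks p i ≡ toFun (wordOf n p) i
    wordOf-toFun i i<n = sym (toFun-fromFun n _ sumBlocks-bounded′ i i<n)

    wordOf-isPerm : IsPerm (wordOf n p)
    wordOf-isPerm = injectiveOn⇒isPerm (wordOf n p) (injectiveOn-resp-≗ wordOf-toFun
      (subst (λ m → InjectiveOn m (sumBlocks p)) size≡ (sumBlocks-injectiveOn p valid)))

    wordOf-avoids : Avoids pat (wordOf n p)
    wordOf-avoids = avoiding⇒avoids (wordOf n p) (avoiding-resp-≗ wordOf-toFun
      (subst (λ m → Avoiding m (sumBlocks p)) size≡ (sumBlocks-avoiding p valid)))

  avoiders-unique : ∀ n → Unique (avoiders n)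
  avoiders-unique n = map-unique-on (wordOf n) (decompositions-unique n n) λ {p} {q} p∈ q∈ eq →
    let valid-p , size-p = decompositions-sound n n p∈
        valid-q , size-q = decompositions-sound n n q∈
    in sumBlocks-injective p q valid-p valid-q (trans size-p (sym size-q)) λ i i<size →
         let i<n = subst (i <_) size-p i<size in
         trans (wordOf-toFun p∈ i i<n) (trans (cong (λ w → toFun w i) eq) (sym (wordOf-toFun q∈ i i<n)))

  avoiders-sound : ∀ n π → π ∈ avoiders n → IsPerm π × Avoids pat π
  avoiders-sound n π π∈ with ∈-map⁻ (wordOf n) π∈
  ... | p , p∈ , refl = wordOf-isPerm p∈ , wordOf-avoids p∈

  avoiders-complete : ∀ n π → IsPerm π → Avoids pat π → π ∈ avoiders n
  avoiders-complete n π perm avoids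
    with decomposable n (toFun π) (toFun-bounded π) (isPerm⇒injectiveOn π perm) (avoids⇒avoiding π avoids)
  ... | p , valid , size≡ , π≗p =
    subst (_∈ avoiders n) π≡ (∈-map⁺ (wordOf n) (decompositions-complete n n p valid size≡ ≤-refl))
    where
    π≡ : wordOf n p ≡ π
    π≡ = trans (fromFun-cong n (λ i i<n → sym (π≗p i i<n))) (fromFun-toFun π)

  numAvoiders-count : ∀ n → NumAvoiders pat n (count n)
  numAvoiders-count n =
    avoiders n , avoiders-unique n ,
    (λ π → mk⇔ (avoiders-sound n π) (λ (perm , avoids) → avoiders-complete n π perm avoids)) ,
    length-map (wordOf n) (decompositions n n)

  -- The recurrence

  sumBelow-+ : ∀ n (f g : ℕ → ℕ) → sumBelow n (λ r → f r + g r) ≡ sumBelow n f + sumBelow n g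
  sumBelow-+ zero f g = refl
  sumBelow-+ (suc n) f g =
    trans (cong (_+ (f n + g n)) (sumBelow-+ n f g)) (interchange (sumBelow n f) (sumBelow n g) (f n) (g n))
    where
    interchange : ∀ a b c d → a + b + (c + d) ≡ a + c + (b + d)
    interchange = solve-∀

  sumBelow-* : ∀ n c (f : ℕ → ℕ) → sumBelow n (λ r → c * f r) ≡ c * sumBelow n f
  sumBelow-* zero c f = sym (*-zeroʳ c)
  sumBelow-* (suc n) c f = trans (cong (_+ c * f n) (sumBelow-* n c f)) (sym (*-distribˡ-+ c (sumBelow n f) (f n)))

  -- The contribution to count (1 + c + m) of decompositions whose tail has size at most m.
  shortTails : ℕ → ℕ → ℕ
  shortTails c m = sumBelow (suc m) (λ r → blockCount (suc (c + (m ∸ r))) * count r)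

  shortTails-convolution : ∀ c m → sumBelow (suc m) (λ r → blockCount (suc ((c + m) ∸ r)) * count r) ≡ shortTails c m
  shortTails-convolution c m = sumBelow-cong (suc m) λ r r<1+m →
    cong (λ x → blockCount (suc x) * count r) (+-∸-assoc c (s≤s⁻¹ r<1+m))

  count-2+m : ∀ m → count (2 + m) ≡ shortTails 1 m + 1 * count (1 + m)
  count-2+m m = trans (count-convolution (suc m))
    (cong₂ _+_ (shortTails-convolution 1 m) (cong (λ x → blockCount (suc x) * count (suc m)) (n∸n≡0 m)))

  count-3+m : ∀ m → count (3 + m) ≡ shortTails 2 m + 1 * count (1 + m) + 1 * count (2 + m)
  count-3+m m = trans (count-convolution (2 + m))
    (cong₂ _+_ (cong₂ _+_ (shortTails-convolution 2 m) (cong (λ x → blockCount (suc x) * count (suc m)) (m+n∸n≡m 1 m)))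
               (cong (λ x → blockCount (suc x) * count (2 + m)) (n∸n≡0 m)))

  count-4+m : ∀ m → count (4 + m) ≡ shortTails 3 m + 3 * count (1 + m) + 1 * count (2 + m) + 1 * count (3 + m)
  count-4+m m = trans (count-convolution (3 + m))
    (cong₂ _+_ (cong₂ _+_ (cong₂ _+_ (shortTails-convolution 3 m)
                                     (cong (λ x → blockCount (suc x) * count (suc m)) (m+n∸n≡m 2 m)))
                          (cong (λ x → blockCount (suc x) * count (2 + m)) (m+n∸n≡m 1 m)))
               (cong (λ x → blockCount (suc x) * count (3 + m)) (n∸n≡0 m)))

  -- blockCount (1 + j) = j² - j + 1 is quadratic in j, so its third difference vanishes.
  blockCount-third-difference : ∀ j → blockCount (4 + j) + 3 * blockCount (2 + j) ≡ 3 * blockCount (3 + j) + blockCount (1 + j)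
  blockCount-third-difference zero = refl
  blockCount-third-difference (suc i) = expand i
    where
    expand : ∀ i → (4 + i) * (3 + i) + 1 + 3 * ((2 + i) * (1 + i) + 1) ≡ 3 * ((3 + i) * (2 + i) + 1) + ((1 + i) * i + 1)
    expand = solve-∀

  shortTails-third-difference : ∀ m → shortTails 3 m + 3 * shortTails 1 m ≡ 3 * shortTails 2 m + shortTails 0 m
  shortTails-third-difference m = begin
    shortTails 3 m + 3 * shortTails 1 m                       ≡⟨ cong (shortTails 3 m +_) (sumBelow-* (suc m) 3 (T 1)) ⟨
    shortTails 3 m + sumBelow (suc m) (λ r → 3 * T 1 r)       ≡⟨ sumBelow-+ (suc m) (T 3) (λ r → 3 * T 1 r) ⟨
    sumBelow (suc m) (λ r → T 3 r + 3 * T 1 r)                ≡⟨ sumBelow-cong (suc m) (λ r _ → termwise (m ∸ r) (count r)) ⟩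
    sumBelow (suc m) (λ r → 3 * T 2 r + T 0 r)                ≡⟨ sumBelow-+ (suc m) (λ r → 3 * T 2 r) (T 0) ⟩
    sumBelow (suc m) (λ r → 3 * T 2 r) + shortTails 0 m       ≡⟨ cong (_+ shortTails 0 m) (sumBelow-* (suc m) 3 (T 2)) ⟩
    3 * shortTails 2 m + shortTails 0 m                       ∎
    where
    open ≡-Reasoning
    T : ℕ → ℕ → ℕ
    T c r = blockCount (suc (c + (m ∸ r))) * count r
    factor : ∀ x y a → x * a + 3 * (y * a) ≡ (x + 3 * y) * a
    factor = solve-∀
    expand : ∀ x y a → (3 * x + y) * a ≡ 3 * (x * a) + y * a
    expand = solve-∀
    termwise : ∀ j a → blockCount (4 + j) * a + 3 * (blockCount (2 + j) * a)
                     ≡ 3 * (blockCount (3 + j) * a) + blockCount (1 + j) * a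
    termwise j a = trans (factor (blockCount (4 + j)) (blockCount (2 + j)) a)
      (trans (cong (_* a) (blockCount-third-difference j)) (expand (blockCount (3 + j)) (blockCount (1 + j)) a))

  Recurrence : (ℕ → ℕ) → Set
  Recurrence a = ∀ m → a (4 + m) + 5 * a (2 + m) ≡ 4 * a (3 + m) + 4 * a (1 + m)

  recurrence-resp-≗ : ∀ {a b} → (∀ n → a n ≡ b n) → Recurrence b → Recurrence a
  recurrence-resp-≗ a≗b rec m rewrite a≗b (1 + m) | a≗b (2 + m) | a≗b (3 + m) | a≗b (4 + m) = rec m

  count-recurrence : Recurrence count
  count-recurrence m
    rewrite count-4+m m | count-3+m m | count-2+m m | count-convolution m | shortTails-convolution 0 m =
    trans (regroup (shortTails 0 m) (shortTails 1 m) (shortTails 2 m) (shortTails 3 m))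
      (trans (cong (_+ (4 * shortTails 1 m + shortTails 2 m + 11 * shortTails 0 m)) (shortTails-third-difference m))
        (collect (shortTails 0 m) (shortTails 1 m) (shortTails 2 m)))
    where
    regroup : ∀ a b c d → d + 3 * a + 1 * (b + 1 * a) + 1 * (c + 1 * a + 1 * (b + 1 * a)) + 5 * (b + 1 * a)
                          ≡ (d + 3 * b) + (4 * b + c + 11 * a)
    regroup = solve-∀
    collect : ∀ a b c → (3 * c + a) + (4 * b + c + 11 * a) ≡ 4 * (c + 1 * a + 1 * (b + 1 * a)) + 4 * a
    collect = solve-∀

open Enumeration using (count; numAvoiders-count; numAvoiders-unique; Recurrence; recurrence-resp-≗; count-recurrence)

open import Defs
import Data.Nat as ℕ
open import Data.Nat using (ℕ; zero; suc; _+_)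
import Data.Nat.Properties as ℕₚ
open import Data.Integer using (ℤ; +_; -_; _*_; _-_) renaming (_+_ to _+ℤ_)
open import Data.Integer.Properties using (pos-+; pos-*; +-identityʳ)
open import Data.Integer.Tactic.RingSolver using (solve-∀)
open import Data.List using (_∷_; [])
open import Data.Product using (∃; _×_; _,_)
open import Relation.Binary.PropositionalEquality as ≡ using (_≡_; refl; sym; cong; cong₂; module ≡-Reasoning)

ℕ-identity⇒ℤ : ∀ w y z x → w + 5 ℕ.* y ≡ 4 ℕ.* z + 4 ℕ.* x → + w +ℤ + 5 * + y ≡ + 4 * + z +ℤ + 4 * + x
ℕ-identity⇒ℤ w y z x eq = begin
  + w +ℤ + 5 * + y          ≡⟨ cong (+ w +ℤ_) (pos-* 5 y) ⟨
  + w +ℤ + (5 ℕ.* y)        ≡⟨ pos-+ w (5 ℕ.* y) ⟨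
  + (w + 5 ℕ.* y)           ≡⟨ cong +_ eq ⟩
  + (4 ℕ.* z + 4 ℕ.* x)     ≡⟨ pos-+ (4 ℕ.* z) (4 ℕ.* x) ⟩
  + (4 ℕ.* z) +ℤ + (4 ℕ.* x) ≡⟨ cong₂ _+ℤ_ (pos-* 4 z) (pos-* 4 x) ⟩
  + 4 * + z +ℤ + 4 * + x    ∎
  where open ≡-Reasoning

recurrence-ℤ : ∀ a → Recurrence a →
  ∀ n → + a (n + 6) ≡ ((+ 4 * + a (n + 5)) - (+ 5 * + a (n + 4))) +ℤ (+ 4 * + a (n + 3))
recurrence-ℤ a rec n rewrite ℕₚ.+-comm n 6 | ℕₚ.+-comm n 5 | ℕₚ.+-comm n 4 | ℕₚ.+-comm n 3 =
  isolate (+ a (6 + n)) (+ a (4 + n)) (+ a (5 + n)) (+ a (3 + n))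
    (ℕ-identity⇒ℤ (a (6 + n)) (a (4 + n)) (a (5 + n)) (a (3 + n)) (rec (2 + n)))
  where
  open ≡-Reasoning
  isolate : ∀ w y z x → w +ℤ + 5 * y ≡ + 4 * z +ℤ + 4 * x → w ≡ ((+ 4 * z) - (+ 5 * y)) +ℤ (+ 4 * x)
  isolate w y z x eq = begin
    w                                   ≡⟨ cancel w y ⟩
    (w +ℤ + 5 * y) - + 5 * y            ≡⟨ cong (_- + 5 * y) eq ⟩
    (+ 4 * z +ℤ + 4 * x) - + 5 * y      ≡⟨ rearrange y z x ⟩
    ((+ 4 * z) - (+ 5 * y)) +ℤ (+ 4 * x) ∎
    where
    cancel : ∀ w y → w ≡ (w +ℤ + 5 * y) - + 5 * y
    cancel = solve-∀
    rearrange : ∀ y z x → (+ 4 * z +ℤ + 4 * x) - + 5 * y ≡ ((+ 4 * z) - (+ 5 * y)) +ℤ (+ 4 * x)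
    rearrange = solve-∀

sumUpTo-vanishing : ∀ k f → (∀ x → f (suc k + x) ≡ + 0) → ∀ j → sumUpTo (k + j) f ≡ sumUpTo k f
sumUpTo-vanishing k f vanish zero = cong (λ i → sumUpTo i f) (ℕₚ.+-identityʳ k)
sumUpTo-vanishing k f vanish (suc j) rewrite ℕₚ.+-suc k j =
  ≡.trans (cong (sumUpTo (k + j) f +ℤ_) (vanish j)) (≡.trans (+-identityʳ _) (sumUpTo-vanishing k f vanish j))

generating-function : ∀ a → a 0 ≡ 1 → a 1 ≡ 1 → a 2 ≡ 2 → a 3 ≡ 6 → Recurrence a →
  ∀ n → (poly (+ 1 ∷ - + 4 ∷ + 5 ∷ - + 4 ∷ []) ⋆ toSeries a) n ≡ poly (+ 1 ∷ - + 3 ∷ + 3 ∷ - + 1 ∷ []) n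
generating-function a a0 a1 a2 a3 rec 0 rewrite a0 = refl
generating-function a a0 a1 a2 a3 rec 1 rewrite a0 | a1 = refl
generating-function a a0 a1 a2 a3 rec 2 rewrite a0 | a1 | a2 = refl
generating-function a a0 a1 a2 a3 rec 3 rewrite a0 | a1 | a2 | a3 = refl
generating-function a a0 a1 a2 a3 rec (suc (suc (suc (suc m)))) =
  ≡.trans (sumUpTo-vanishing 3 _ (λ _ → refl) (suc m))
    (vanishes (+ a (4 + m)) (+ a (2 + m)) (+ a (3 + m)) (+ a (1 + m))
      (ℕ-identity⇒ℤ (a (4 + m)) (a (2 + m)) (a (3 + m)) (a (1 + m)) (rec m)))
  where
  open ≡-Reasoning
  vanishes : ∀ w y z x → w +ℤ + 5 * y ≡ + 4 * z +ℤ + 4 * x →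
    ((+ 1 * w +ℤ (- + 4) * z) +ℤ + 5 * y) +ℤ (- + 4) * x ≡ + 0
  vanishes w y z x eq = begin
    ((+ 1 * w +ℤ (- + 4) * z) +ℤ + 5 * y) +ℤ (- + 4) * x ≡⟨ regroup w y z x ⟩
    (w +ℤ + 5 * y) - (+ 4 * z +ℤ + 4 * x)                ≡⟨ cong (_- (+ 4 * z +ℤ + 4 * x)) eq ⟩
    (+ 4 * z +ℤ + 4 * x) - (+ 4 * z +ℤ + 4 * x)          ≡⟨ self-difference (+ 4 * z +ℤ + 4 * x) ⟩
    + 0                                                  ∎
    where
    regroup : ∀ w y z x → ((+ 1 * w +ℤ (- + 4) * z) +ℤ + 5 * y) +ℤ (- + 4) * x ≡ (w +ℤ + 5 * y) - (+ 4 * z +ℤ + 4 * x)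
    regroup = solve-∀
    self-difference : ∀ u → u - u ≡ + 0
    self-difference = solve-∀

theorem17 : (∃ λ (a : ℕ → ℕ) → ∀ n → NumAvoiders pat n (a n))
    × (∀ (a : ℕ → ℕ) → (∀ n → NumAvoiders pat n (a n)) →
        (a 0 ≡ 1 × a 1 ≡ 1 × a 2 ≡ 2 × a 3 ≡ 6 × a 4 ≡ 18 × a 5 ≡ 50)
        × (∀ n → + a (n + 6) ≡ ((+ 4 * + a (n + 5)) - (+ 5 * + a (n + 4))) +ℤ (+ 4 * + a (n + 3)))
        × (∀ n → (poly (+ 1 ∷ - + 4 ∷ + 5 ∷ - + 4 ∷ []) ⋆ toSeries a) n
                 ≡ poly (+ 1 ∷ - + 3 ∷ + 3 ∷ - + 1 ∷ []) n))
theorem17 = (count , numAvoiders-count) , λ a counts →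
  let a≗count : ∀ n → a n ≡ count n
      a≗count n = numAvoiders-unique pat n (counts n) (numAvoiders-count n)
      rec : Recurrence a
      rec = recurrence-resp-≗ a≗count count-recurrence
  in (a≗count 0 , a≗count 1 , a≗count 2 , a≗count 3 , a≗count 4 , a≗count 5) ,
     recurrence-ℤ a rec ,
     generating-function a (a≗count 0) (a≗count 1) (a≗count 2) (a≗count 3) rec
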